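{- If $G$ is a multigraph with $m\ge 2^{16}$ edges and maximum edge multiplicity $\mu\ge 1$, then $\operatorname{ch}_{a}(G) \le 2^{11/4}\sqrt{e}\, (\mu m)^{1/4}$, where $e$ is Euler's number.
   Context: Graphs are finite multigraphs (parallel edges allowed). A $k$-list-assignment of $G=(V,E)$ is a map $L$ assigning to each vertex a set $L(v)$ of $k$ positive integers; an $L$-colouring is a map $c$ with $c(v)\in L(v)$ for all $v$. Given a labelling $\ell:E\to\mathbb{Z}^+$ of the edges, a (not necessarily proper) colouring $c$ is adapted to $\ell$ if no edge $e=uv$ has $c(u)=c(v)=\ell(e)$. $G$ is adaptably $k$-choosable if for every $k$-list-assignment $L$ and every labelling $\ell$ there is an $L$-colouring adapted to $\ell$; the adaptable choosability $\operatorname{ch}_a(G)$ is the least such $k$. -}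

module Defs where

open import Data.Nat using (ℕ; zero; suc; _+_; _*_; _^_; _≤_; _<_; _!)
open import Data.Fin using (Fin; _≟_)
open import Data.Product using (_×_; _,_; proj₁; proj₂; ∃; ∃-syntax)
open import Data.Sum using (_⊎_)
open import Data.List using (List; length; allFin)
open import Data.List.Relation.Unary.All using (All)
open import Data.List.Relation.Unary.Unique.Propositional using (Unique)
open import Data.List.Membership.Propositional using (_∈_)
open import Relation.Binary.PropositionalEquality using (_≡_; _≢_)
open import Relation.Nullary using (¬_; Dec; yes; no)
open import Relation.Nullary.Decidable using (_×-dec_; _⊎-dec_)

record Multigraph : Set where
  field
    n        : ℕ
    m        : ℕ
    ends     : Fin m → Fin n × Fin n
    loopless : ∀ e → proj₁ (ends e) ≢ proj₂ (ends e)
open Multigraph public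

Joins : (G : Multigraph) → Fin (n G) → Fin (n G) → Fin (m G) → Set
Joins G u v e = (proj₁ (ends G e) ≡ u × proj₂ (ends G e) ≡ v)
              ⊎ (proj₁ (ends G e) ≡ v × proj₂ (ends G e) ≡ u)

joins? : (G : Multigraph) → ∀ u v e → Dec (Joins G u v e)
joins? G u v e = ((proj₁ (ends G e) ≟ u) ×-dec (proj₂ (ends G e) ≟ v))
          ⊎-dec ((proj₁ (ends G e) ≟ v) ×-dec (proj₂ (ends G e) ≟ u))

countL : {A : Set} {P : A → Set} → (∀ x → Dec (P x)) → List A → ℕ
countL d List.[] = 0
countL d (x List.∷ xs) with d x
... | yes _ = suc (countL d xs)
... | no  _ = countL d xs

multiplicity : (G : Multigraph) → Fin (n G) → Fin (n G) → ℕ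
multiplicity G u v = countL (joins? G u v) (allFin (m G))

IsMaxMultiplicity : Multigraph → ℕ → Set
IsMaxMultiplicity G μ =
  (∀ u v → multiplicity G u v ≤ μ) × (∃[ u ] ∃[ v ] multiplicity G u v ≡ μ)

IsListAssignment : (G : Multigraph) → ℕ → (Fin (n G) → List ℕ) → Set
IsListAssignment G k L =
  ∀ v → (length (L v) ≡ k) × Unique (L v) × All (λ x → 1 ≤ x) (L v)

IsLabelling : (G : Multigraph) → (Fin (m G) → ℕ) → Set
IsLabelling G ℓ = ∀ e → 1 ≤ ℓ e

IsLColouring : (G : Multigraph) → (Fin (n G) → List ℕ) → (Fin (n G) → ℕ) → Set
IsLColouring G L c = ∀ v → c v ∈ L v

Adapted : (G : Multigraph) → (Fin (m G) → ℕ) → (Fin (n G) → ℕ) → Set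
Adapted G ℓ c = ∀ e → ¬ (c (proj₁ (ends G e)) ≡ ℓ e × c (proj₂ (ends G e)) ≡ ℓ e)

AdaptablyChoosable : Multigraph → ℕ → Set
AdaptablyChoosable G k =
  ∀ (L : Fin (n G) → List ℕ) (ℓ : Fin (m G) → ℕ) →
  IsListAssignment G k L → IsLabelling G ℓ →
  ∃[ c ] (IsLColouring G L c × Adapted G ℓ c)

-- T N = Σ_{i=0}^{N} 2^i · N!/i!, so T N / N! is the N-th partial sum of e² = Σ 2^i/i!
T : ℕ → ℕ
T zero    = 1
T (suc N) = suc N * T N + 2 ^ suc N

-- k ≤ 2^{11/4} √e (μ m)^{1/4}  ⟺  k⁴ ≤ 2^{11} e² μ m
--   ⟺ (e² irrational, partial sums increase strictly to e²)
--   ∃ N. k⁴ ≤ 2^{11} μ m · T N / N!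
WithinBound : ℕ → ℕ → ℕ → Set
WithinBound μ m k = ∃[ N ] (k ^ 4 * N ! ≤ 2 ^ 11 * μ * m * T N)

-- Split the vertices at degree j², where j is least with 2μm ≤ j⁴. At most 2m/j² vertices are
-- high, so each vertex has at most μ·2m/j² ≤ j² edges to high vertices, and low vertices have
-- degree at most j².
-- If every vertex of R has a list of κ colours and at most κ²/4 edges inside R, deleting a vertex
-- from T ⊆ R divides the number of adapted colourings of T by at most κ/2 (Rosenfeld's counting);
-- hence adapted colourings of R exist.
-- The high vertices are coloured from lists of 4j colours. Call a high neighbour u of a low vertex v
-- a blocker if the colour of u is the label of some edge uv. Weighting adapted colourings by 2^(number
-- of blockers of v) increases their number by a factor at most 2^j, and fewer than 2^(j+1) low
-- vertices have an edge since m < 2^j; so some adapted colouring gives every low vertex at most 2j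
-- blockers. The low vertices are then coloured from the at least 2j colours of their lists not
-- blocked, and 4j ≤ 2^(11/4) (μm)^(1/4).

module Submission where

open import Defs
open import Data.Nat using (ℕ; _≤_; _^_)
open import Data.Product using (_×_; ∃-syntax)

open import Data.Nat
open import Data.Nat.Properties
open import Data.Nat.Tactic.RingSolver using (solve-∀)
open import Data.Fin using (Fin; zero; suc) renaming (_≟_ to _≟ᶠ_)
open import Data.Fin.Properties using (all?; any?; ¬∀⟶∃¬) renaming (suc-injective to fsuc-injective)
open import Data.Fin.Subset using (Subset; _-_; _⊆_; ∣_∣; ∁) renaming (_∈_ to _∈ₛ_; _∉_ to _∉ₛ_)
open import Data.Fin.Subset.Properties using (_∈?_; nonempty?; p─q⊆p; x∈p∧x≢y⇒x∈p-y; x∈p⇒∣p-x∣<∣p∣; x∈∁p⇒x∉p; x∉p⇒x∈∁p; x∈p⇒x∉∁p)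
open import Data.List using (List; []; _∷_; length; allFin; filter)
open import Data.List.Membership.Propositional using (_∈_)
open import Data.List.Membership.Propositional.Properties using (∈-allFin; ∈-filter⁻)
open import Data.List.Relation.Unary.Any using (here; there)
open import Data.List.Relation.Unary.Any.Properties using (singleton⁻)
import Data.List.Relation.Unary.All as All
open import Data.List.Relation.Unary.Unique.Propositional using (Unique; []; _∷_)
open import Data.List.Relation.Unary.Unique.Propositional.Properties using (allFin⁺; filter⁺)
open import Data.List.Properties using (length-tabulate)
open import Data.Bool using (if_then_else_)
open import Data.Vec using (Vec; []; _∷_; lookup; _[_]≔_; replicate; tabulate; here; there)
open import Data.Vec.Properties using (lookup∘update; lookup∘update′; lookup-replicate; lookup∘tabulate; lookup⇒[]=; []=⇒lookup)
open import Data.Product using (_,_; proj₁; proj₂)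
open import Data.Sum using (inj₁; inj₂)
open import Data.Empty using (⊥; ⊥-elim)
open import Function using (_∘_; id)
open import Relation.Binary.Definitions using (DecidableEquality)
open import Relation.Binary.PropositionalEquality
open import Relation.Nullary
open import Relation.Nullary.Decidable using (dec-true; dec-false; decidable-stable; _×-dec_)
open import Relation.Unary using (Decidable)
import Algebra.Properties.CommutativeSemigroup +-commutativeSemigroup as +-CS
import Algebra.Properties.CommutativeSemigroup *-commutativeSemigroup as *-CS

𝟙 : {P : Set} → Dec P → ℕ
𝟙 (yes _) = 1
𝟙 (no _)  = 0

𝟙-yes : {P : Set} (d : Dec P) → P → 𝟙 d ≡ 1
𝟙-yes (yes _) _ = refl
𝟙-yes (no ¬p) p = ⊥-elim (¬p p)

𝟙-no : {P : Set} (d : Dec P) → ¬ P → 𝟙 d ≡ 0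
𝟙-no (yes p) ¬p = ⊥-elim (¬p p)
𝟙-no (no _)  _  = refl

𝟙>0⇒ : {P : Set} (d : Dec P) → 0 < 𝟙 d → P
𝟙>0⇒ (yes p) _ = p

𝟙-mono : {P Q : Set} → (P → Q) → (p : Dec P) (q : Dec Q) → 𝟙 p ≤ 𝟙 q
𝟙-mono P⇒Q (no _)  q       = z≤n
𝟙-mono P⇒Q (yes p) (yes _) = ≤-refl
𝟙-mono P⇒Q (yes p) (no ¬q) = ⊥-elim (¬q (P⇒Q p))

2^[𝟙+n] : {P : Set} (d : Dec P) (n : ℕ) → 2 ^ (𝟙 d + n) ≡ 2 ^ n + 𝟙 d * 2 ^ n
2^[𝟙+n] (yes _) n = refl
2^[𝟙+n] (no _)  n = sym (+-identityʳ (2 ^ n))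

𝟙≤1 : {P : Set} (d : Dec P) → 𝟙 d ≤ 1
𝟙≤1 (yes _) = ≤-refl
𝟙≤1 (no _)  = z≤n

module _ {A : Set} where

  ∑ : List A → (A → ℕ) → ℕ
  ∑ []       f = 0
  ∑ (x ∷ xs) f = f x + ∑ xs f

  ∑-mono : ∀ xs {f g : A → ℕ} → (∀ x → x ∈ xs → f x ≤ g x) → ∑ xs f ≤ ∑ xs g
  ∑-mono []       f≤g = z≤n
  ∑-mono (x ∷ xs) f≤g = +-mono-≤ (f≤g x (here refl)) (∑-mono xs (λ y → f≤g y ∘ there))

  ∑-cong : ∀ xs {f g : A → ℕ} → (∀ x → x ∈ xs → f x ≡ g x) → ∑ xs f ≡ ∑ xs g
  ∑-cong []       f≡g = refl
  ∑-cong (x ∷ xs) f≡g = cong₂ _+_ (f≡g x (here refl)) (∑-cong xs (λ y → f≡g y ∘ there))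

  ∑-distrib-+ : ∀ xs (f g : A → ℕ) → ∑ xs (λ x → f x + g x) ≡ ∑ xs f + ∑ xs g
  ∑-distrib-+ []       f g = refl
  ∑-distrib-+ (x ∷ xs) f g =
    trans (cong (f x + g x +_) (∑-distrib-+ xs f g)) (+-CS.interchange (f x) (g x) (∑ xs f) (∑ xs g))

  ∑-*ˡ : ∀ xs a (f : A → ℕ) → ∑ xs (λ x → a * f x) ≡ a * ∑ xs f
  ∑-*ˡ []       a f = sym (*-zeroʳ a)
  ∑-*ˡ (x ∷ xs) a f = trans (cong (a * f x +_) (∑-*ˡ xs a f)) (sym (*-distribˡ-+ a (f x) (∑ xs f)))

  ∑-*ʳ : ∀ xs a (f : A → ℕ) → ∑ xs (λ x → f x * a) ≡ ∑ xs f * a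
  ∑-*ʳ xs a f = trans (∑-cong xs (λ x _ → *-comm (f x) a)) (trans (∑-*ˡ xs a f) (*-comm a (∑ xs f)))

  ∑-const : ∀ xs a → ∑ xs (λ _ → a) ≡ length xs * a
  ∑-const []       a = refl
  ∑-const (x ∷ xs) a = cong (a +_) (∑-const xs a)

  ∑-zero : ∀ xs → ∑ xs (λ _ → 0) ≡ 0
  ∑-zero xs = trans (∑-const xs 0) (*-zeroʳ (length xs))

  ∈⇒≤∑ : ∀ xs (f : A → ℕ) {x} → x ∈ xs → f x ≤ ∑ xs f
  ∈⇒≤∑ (y ∷ xs) f (here refl) = m≤m+n (f y) (∑ xs f)
  ∈⇒≤∑ (y ∷ xs) f (there x∈)  = ≤-trans (∈⇒≤∑ xs f x∈) (m≤n+m (∑ xs f) (f y))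

  ∑<∑⇒∃< : ∀ xs {f g : A → ℕ} → ∑ xs f < ∑ xs g → ∃[ x ] x ∈ xs × f x < g x
  ∑<∑⇒∃< (x ∷ xs) {f} {g} lt with f x <? g x
  ... | yes fx<gx = x , here refl , fx<gx
  ... | no  fx≮gx with ∑<∑⇒∃< xs (+-cancelˡ-< (g x) (∑ xs f) (∑ xs g)
                                   (≤-<-trans (+-monoˡ-≤ (∑ xs f) (≮⇒≥ fx≮gx)) lt))
  ...   | y , y∈ , fy<gy = y , there y∈ , fy<gy

  ∑-𝟙≡-unique : (_≟_ : DecidableEquality A) → ∀ xs → Unique xs → ∀ x (F : A → ℕ) →
                ∑ xs (λ y → 𝟙 (y ≟ x) * F y) ≤ F x
  ∑-𝟙≡-unique _≟_ []       _          x F = z≤n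
  ∑-𝟙≡-unique _≟_ (y ∷ xs) (y∉ ∷ uxs) x F with y ≟ x
  ... | no  _    = ∑-𝟙≡-unique _≟_ xs uxs x F
  ... | yes refl = ≤-reflexive (begin
    F y + 0 + ∑ xs (λ z → 𝟙 (z ≟ y) * F z) ≡⟨ cong (F y + 0 +_) (trans (∑-cong xs rest-zero) (∑-zero xs)) ⟩
    F y + 0 + 0                             ≡⟨ trans (+-identityʳ _) (+-identityʳ _) ⟩
    F y                                     ∎)
    where
    open ≡-Reasoning
    rest-zero : ∀ z → z ∈ xs → 𝟙 (z ≟ y) * F z ≡ 0
    rest-zero z z∈ = cong (_* F z) (𝟙-no (z ≟ y) (λ { refl → All.lookup y∉ z∈ refl }))

∑-comm : {A B : Set} (xs : List A) (ys : List B) (f : A → B → ℕ) →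
         ∑ xs (λ x → ∑ ys (f x)) ≡ ∑ ys (λ y → ∑ xs (λ x → f x y))
∑-comm []       ys f = sym (∑-zero ys)
∑-comm (x ∷ xs) ys f =
  trans (cong (∑ ys (f x) +_) (∑-comm xs ys f)) (sym (∑-distrib-+ ys (f x) (λ y → ∑ xs (λ x′ → f x′ y))))

countL≡∑𝟙 : {A : Set} {P : A → Set} (P? : ∀ x → Dec (P x)) (xs : List A) → countL P? xs ≡ ∑ xs (𝟙 ∘ P?)
countL≡∑𝟙 P? []       = refl
countL≡∑𝟙 P? (x ∷ xs) with P? x
... | yes _ = cong suc (countL≡∑𝟙 P? xs)
... | no  _ = countL≡∑𝟙 P? xs

length-filter-¬+∑𝟙 : {A : Set} {P : A → Set} (P? : ∀ x → Dec (P x)) (xs : List A) →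
                     length (filter (¬? ∘ P?) xs) + ∑ xs (𝟙 ∘ P?) ≡ length xs
length-filter-¬+∑𝟙 P? []       = refl
length-filter-¬+∑𝟙 P? (x ∷ xs) with P? x
... | yes _ = trans (+-suc _ _) (cong suc (length-filter-¬+∑𝟙 P? xs))
... | no  _ = cong suc (length-filter-¬+∑𝟙 P? xs)

module _ {A : Set} where

  ∑ᶜ : ∀ {n} → (Fin n → List A) → (Vec A n → ℕ) → ℕ
  ∑ᶜ {zero}  X f = f []
  ∑ᶜ {suc n} X f = ∑ (X zero) λ x → ∑ᶜ (X ∘ suc) (f ∘ (x ∷_))

  _∈ᶜ_ : ∀ {n} → Vec A n → (Fin n → List A) → Set
  c ∈ᶜ X = ∀ i → lookup c i ∈ X i

  ∷-∈ᶜ : ∀ {n} {X : Fin (suc n) → List A} {x c} → x ∈ X zero → c ∈ᶜ (X ∘ suc) → (x ∷ c) ∈ᶜ X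
  ∷-∈ᶜ x∈ c∈ zero    = x∈
  ∷-∈ᶜ x∈ c∈ (suc i) = c∈ i

  ∑ᶜ-mono : ∀ {n} (X : Fin n → List A) {f g : Vec A n → ℕ} → (∀ c → c ∈ᶜ X → f c ≤ g c) → ∑ᶜ X f ≤ ∑ᶜ X g
  ∑ᶜ-mono {zero}  X f≤g = f≤g [] (λ ())
  ∑ᶜ-mono {suc n} X f≤g = ∑-mono (X zero) λ x x∈ → ∑ᶜ-mono (X ∘ suc) λ c c∈ → f≤g (x ∷ c) (∷-∈ᶜ x∈ c∈)

  ∑ᶜ-cong : ∀ {n} (X : Fin n → List A) {f g : Vec A n → ℕ} → (∀ c → c ∈ᶜ X → f c ≡ g c) → ∑ᶜ X f ≡ ∑ᶜ X g
  ∑ᶜ-cong X f≡g = ≤-antisym (∑ᶜ-mono X (λ c c∈ → ≤-reflexive (f≡g c c∈)))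
                            (∑ᶜ-mono X (λ c c∈ → ≤-reflexive (sym (f≡g c c∈))))

  ∑ᶜ-cong-lists : ∀ {n} {X Y : Fin n → List A} (f : Vec A n → ℕ) → (∀ i → X i ≡ Y i) → ∑ᶜ X f ≡ ∑ᶜ Y f
  ∑ᶜ-cong-lists {zero}          f X≡Y = refl
  ∑ᶜ-cong-lists {suc n} {X} {Y} f X≡Y rewrite X≡Y zero =
    ∑-cong (Y zero) (λ x _ → ∑ᶜ-cong-lists (f ∘ (x ∷_)) (X≡Y ∘ suc))

  ∑ᶜ-distrib-+ : ∀ {n} (X : Fin n → List A) (f g : Vec A n → ℕ) → ∑ᶜ X (λ c → f c + g c) ≡ ∑ᶜ X f + ∑ᶜ X g
  ∑ᶜ-distrib-+ {zero}  X f g = refl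
  ∑ᶜ-distrib-+ {suc n} X f g =
    trans (∑-cong (X zero) (λ x _ → ∑ᶜ-distrib-+ (X ∘ suc) (f ∘ (x ∷_)) (g ∘ (x ∷_)))) (∑-distrib-+ (X zero) _ _)

  ∑ᶜ-*ˡ : ∀ {n} (X : Fin n → List A) a (f : Vec A n → ℕ) → ∑ᶜ X (λ c → a * f c) ≡ a * ∑ᶜ X f
  ∑ᶜ-*ˡ {zero}  X a f = refl
  ∑ᶜ-*ˡ {suc n} X a f = trans (∑-cong (X zero) (λ x _ → ∑ᶜ-*ˡ (X ∘ suc) a (f ∘ (x ∷_)))) (∑-*ˡ (X zero) a _)

  ∑ᶜ-zero : ∀ {n} (X : Fin n → List A) → ∑ᶜ X (λ _ → 0) ≡ 0
  ∑ᶜ-zero X = ∑ᶜ-*ˡ X 0 (λ _ → 0)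

  ∑ᶜ-∑ : ∀ {n} {B : Set} (X : Fin n → List A) (ys : List B) (F : B → Vec A n → ℕ) →
         ∑ᶜ X (λ c → ∑ ys (λ y → F y c)) ≡ ∑ ys (λ y → ∑ᶜ X (F y))
  ∑ᶜ-∑ X []       F = ∑ᶜ-zero X
  ∑ᶜ-∑ X (y ∷ ys) F = trans (∑ᶜ-distrib-+ X (F y) _) (cong (∑ᶜ X (F y) +_) (∑ᶜ-∑ X ys F))

  ∑ᶜ<∑ᶜ⇒∃< : ∀ {n} (X : Fin n → List A) {f g : Vec A n → ℕ} → ∑ᶜ X f < ∑ᶜ X g → ∃[ c ] c ∈ᶜ X × f c < g c
  ∑ᶜ<∑ᶜ⇒∃< {zero}  X lt = [] , (λ ()) , lt
  ∑ᶜ<∑ᶜ⇒∃< {suc n} X lt with ∑<∑⇒∃< (X zero) lt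
  ... | x , x∈ , lt′ with ∑ᶜ<∑ᶜ⇒∃< (X ∘ suc) lt′
  ...   | c , c∈ , fc<gc = x ∷ c , ∷-∈ᶜ x∈ c∈ , fc<gc

  ∑ᶜ-singletons : ∀ {n} (X : Fin n → List A) z (f : Vec A n → ℕ) → (∀ i → X i ≡ z ∷ []) → ∑ᶜ X f ≡ f (replicate n z)
  ∑ᶜ-singletons {zero}  X z f X≡z = refl
  ∑ᶜ-singletons {suc n} X z f X≡z rewrite X≡z zero =
    trans (+-identityʳ _) (∑ᶜ-singletons (X ∘ suc) z (f ∘ (z ∷_)) (X≡z ∘ suc))

  ∑ᶜ-split : ∀ {n} (X X′ : Fin n → List A) v z (f : Vec A n → ℕ) →
             (∀ w → w ≢ v → X′ w ≡ X w) → X′ v ≡ z ∷ [] →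
             ∑ᶜ X f ≡ ∑ (X v) (λ y → ∑ᶜ X′ (λ c → f (c [ v ]≔ y)))
  ∑ᶜ-split {suc n} X X′ zero z f X′≡X X′v≡z rewrite X′v≡z =
    ∑-cong (X zero) λ y _ →
      trans (∑ᶜ-cong-lists _ (λ i → sym (X′≡X (suc i) (λ ())))) (sym (+-identityʳ _))
  ∑ᶜ-split {suc n} X X′ (suc v) z f X′≡X X′v≡z = begin
    ∑ (X zero) (λ x → ∑ᶜ (X ∘ suc) (f ∘ (x ∷_)))
      ≡⟨ ∑-cong (X zero) (λ x _ → ∑ᶜ-split (X ∘ suc) (X′ ∘ suc) v z (f ∘ (x ∷_))
                                    (λ w w≢v → X′≡X (suc w) (w≢v ∘ fsuc-injective)) X′v≡z) ⟩
    ∑ (X zero) (λ x → ∑ (X (suc v)) (λ y → ∑ᶜ (X′ ∘ suc) (λ c → f (x ∷ c [ v ]≔ y))))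
      ≡⟨ ∑-comm (X zero) (X (suc v)) _ ⟩
    ∑ (X (suc v)) (λ y → ∑ (X zero) (λ x → ∑ᶜ (X′ ∘ suc) (λ c → f (x ∷ c [ v ]≔ y))))
      ≡⟨ ∑-cong (X (suc v)) (λ y _ → cong (λ xs → ∑ xs _) (sym (X′≡X zero (λ ())))) ⟩
    ∑ (X (suc v)) (λ y → ∑ (X′ zero) (λ x → ∑ᶜ (X′ ∘ suc) (λ c → f (x ∷ c [ v ]≔ y)))) ∎
    where open ≡-Reasoning

m*n<m*o⇒0<m : ∀ {m n o} → m * n < m * o → 0 < m
m*n<m*o⇒0<m {suc m} _ = s≤s z≤n

2a≤b+c⇒c≤a⇒a≤b : ∀ {a b c} → 2 * a ≤ b + c → c ≤ a → a ≤ b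
2a≤b+c⇒c≤a⇒a≤b {a} {b} {c} 2a≤b+c c≤a =
  +-cancelʳ-≤ a a b (≤-trans (≤-reflexive (cong (a +_) (sym (+-identityʳ a)))) (≤-trans 2a≤b+c (+-monoʳ-≤ b c≤a)))

2n+2n≡4n : ∀ n → 2 * n + 2 * n ≡ 4 * n
2n+2n≡4n = solve-∀

∏ : {A : Set} → List A → (A → ℕ) → ℕ
∏ []       f = 1
∏ (x ∷ xs) f = f x * ∏ xs f

bernoulli : ∀ κ b a → (κ + b * a) * κ ^ a ≤ κ * (κ + b) ^ a
bernoulli κ b zero    = ≤-reflexive (trans (cong (λ t → (κ + t) * 1) (*-zeroʳ b)) (cong (_* 1) (+-identityʳ κ)))
bernoulli κ b (suc a) = begin
  (κ + b * suc a) * κ ^ suc a                 ≡⟨ expand κ b a (κ ^ a) ⟩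
  κ * ((κ + b * a) * κ ^ a) + b * (κ * κ ^ a) ≤⟨ +-mono-≤ (*-monoʳ-≤ κ (bernoulli κ b a))
                                                          (*-monoʳ-≤ b (*-monoʳ-≤ κ (^-monoˡ-≤ a (m≤m+n κ b)))) ⟩
  κ * (κ * (κ + b) ^ a) + b * (κ * (κ + b) ^ a) ≡⟨ collect κ b ((κ + b) ^ a) ⟩
  κ * ((κ + b) * (κ + b) ^ a)                 ∎
  where
  open ≤-Reasoning
  expand : ∀ κ b a p → (κ + b * suc a) * (κ * p) ≡ κ * ((κ + b * a) * p) + b * (κ * p)
  expand = solve-∀
  collect : ∀ κ b q → κ * (κ * q) + b * (κ * q) ≡ κ * ((κ + b) * q)
  collect = solve-∀

∏-bernoulli : {A : Set} (κ b : ℕ) (a : A → ℕ) (us : List A) →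
              ∏ us (λ u → κ + b * a u) * κ ^ ∑ us a ≤ κ ^ length us * (κ + b) ^ ∑ us a
∏-bernoulli κ b a []       = ≤-refl
∏-bernoulli κ b a (u ∷ us) = begin
  (κ + b * a u) * P * κ ^ (a u + S)                     ≡⟨ cong ((κ + b * a u) * P *_) (^-distribˡ-+-* κ (a u) S) ⟩
  (κ + b * a u) * P * (κ ^ a u * κ ^ S)                 ≡⟨ *-CS.interchange (κ + b * a u) P (κ ^ a u) (κ ^ S) ⟩
  ((κ + b * a u) * κ ^ a u) * (P * κ ^ S)               ≤⟨ *-mono-≤ (bernoulli κ b (a u)) (∏-bernoulli κ b a us) ⟩
  (κ * (κ + b) ^ a u) * (κ ^ length us * (κ + b) ^ S)   ≡⟨ *-CS.interchange κ ((κ + b) ^ a u) (κ ^ length us) ((κ + b) ^ S) ⟩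
  κ * κ ^ length us * ((κ + b) ^ a u * (κ + b) ^ S)     ≡⟨ cong (κ * κ ^ length us *_) (^-distribˡ-+-* (κ + b) (a u) S) ⟨
  κ * κ ^ length us * (κ + b) ^ (a u + S)               ∎
  where
  open ≤-Reasoning
  P = ∏ us (λ u → κ + b * a u)
  S = ∑ us a

reverse-bernoulli : ∀ κ b i d → d + b * i ≤ κ → (κ + b) ^ i * d ≤ κ ^ i * (d + b * i)
reverse-bernoulli κ b zero    d _ = ≤-reflexive (cong (1 *_) (sym (trans (cong (d +_) (*-zeroʳ b)) (+-identityʳ d))))
reverse-bernoulli κ b (suc i) d d+b[1+i]≤κ = begin
  (κ + b) * (κ + b) ^ i * d      ≡⟨ *-CS.xy∙z≈y∙xz (κ + b) ((κ + b) ^ i) d ⟩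
  (κ + b) ^ i * ((κ + b) * d)    ≤⟨ *-monoʳ-≤ ((κ + b) ^ i) step ⟩
  (κ + b) ^ i * (κ * (d + b))    ≡⟨ *-CS.x∙yz≈y∙xz ((κ + b) ^ i) κ (d + b) ⟩
  κ * ((κ + b) ^ i * (d + b))    ≤⟨ *-monoʳ-≤ κ (reverse-bernoulli κ b i (d + b) (≤-trans (≤-reflexive (shift d b i)) d+b[1+i]≤κ)) ⟩
  κ * (κ ^ i * (d + b + b * i))  ≡⟨ trans (sym (*-assoc κ (κ ^ i) _)) (cong (κ * κ ^ i *_) (shift d b i)) ⟩
  κ * κ ^ i * (d + b * suc i)    ∎
  where
  open ≤-Reasoning
  shift : ∀ d b i → d + b + b * i ≡ d + b * suc i
  shift = solve-∀
  step : (κ + b) * d ≤ κ * (d + b)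
  step = begin
    (κ + b) * d    ≡⟨ *-distribʳ-+ d κ b ⟩
    κ * d + b * d  ≤⟨ +-monoʳ-≤ (κ * d) (*-monoʳ-≤ b (≤-trans (m≤m+n d (b * suc i)) d+b[1+i]≤κ)) ⟩
    κ * d + b * κ  ≡⟨ cong (κ * d +_) (*-comm b κ) ⟩
    κ * d + κ * b  ≡⟨ *-distribˡ-+ κ d b ⟨
    κ * (d + b)    ∎

[4j+2]^i≤2[4j]^i : ∀ j i → 1 ≤ j → i ≤ j → (4 * j + 2) ^ i ≤ 2 * (4 * j) ^ i
[4j+2]^i≤2[4j]^i j i 1≤j i≤j = *-cancelʳ-≤ _ _ (2 * j) {{>-nonZero (≤-trans 1≤j (m≤n*m j 2))}} (begin
  (4 * j + 2) ^ i * (2 * j)     ≤⟨ reverse-bernoulli (4 * j) 2 i (2 * j) 2j+2i≤4j ⟩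
  (4 * j) ^ i * (2 * j + 2 * i) ≤⟨ *-monoʳ-≤ ((4 * j) ^ i) 2j+2i≤4j ⟩
  (4 * j) ^ i * (4 * j)         ≡⟨ rearrange ((4 * j) ^ i) j ⟩
  2 * (4 * j) ^ i * (2 * j)     ∎)
  where
  open ≤-Reasoning
  rearrange : ∀ p j → p * (4 * j) ≡ 2 * p * (2 * j)
  rearrange = solve-∀
  2j+2i≤4j : 2 * j + 2 * i ≤ 4 * j
  2j+2i≤4j = ≤-trans (+-monoʳ-≤ (2 * j) (*-monoʳ-≤ 2 i≤j)) (≤-reflexive (2n+2n≡4n j))

[4j+2]^D≤2^t[4j]^D : ∀ j t D → 1 ≤ j → D ≤ j * t → (4 * j + 2) ^ D ≤ 2 ^ t * (4 * j) ^ D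
[4j+2]^D≤2^t[4j]^D j zero zero    _ _ = ≤-refl
[4j+2]^D≤2^t[4j]^D j zero (suc D) _ D≤0 = ⊥-elim (n≮0 (≤-trans D≤0 (≤-reflexive (*-zeroʳ j))))
[4j+2]^D≤2^t[4j]^D j (suc t) D 1≤j D≤j[1+t] with D ≤? j
... | yes D≤j = ≤-trans ([4j+2]^i≤2[4j]^i j D 1≤j D≤j) (*-monoˡ-≤ ((4 * j) ^ D) (*-monoʳ-≤ 2 (m^n>0 2 t)))
... | no  D≰j = subst (λ E → (4 * j + 2) ^ E ≤ 2 ^ suc t * (4 * j) ^ E) (sym D≡j+D′) (begin
  (4 * j + 2) ^ (j + D′)                   ≡⟨ ^-distribˡ-+-* (4 * j + 2) j D′ ⟩
  (4 * j + 2) ^ j * (4 * j + 2) ^ D′       ≤⟨ *-mono-≤ ([4j+2]^i≤2[4j]^i j j 1≤j ≤-refl) ([4j+2]^D≤2^t[4j]^D j t D′ 1≤j D′≤jt) ⟩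
  2 * (4 * j) ^ j * (2 ^ t * (4 * j) ^ D′) ≡⟨ *-CS.interchange 2 ((4 * j) ^ j) (2 ^ t) ((4 * j) ^ D′) ⟩
  2 * 2 ^ t * ((4 * j) ^ j * (4 * j) ^ D′) ≡⟨ cong (2 * 2 ^ t *_) (^-distribˡ-+-* (4 * j) j D′) ⟨
  2 * 2 ^ t * (4 * j) ^ (j + D′)           ∎)
  where
  open ≤-Reasoning
  D′ = D ∸ j
  D≡j+D′ : D ≡ j + D′
  D≡j+D′ = sym (m+[n∸m]≡n (<⇒≤ (≰⇒> D≰j)))
  D′≤jt : D′ ≤ j * t
  D′≤jt = ≤-trans (∸-monoˡ-≤ j D≤j[1+t]) (≤-reflexive (trans (cong (_∸ j) (*-suc j t)) (m+n∸m≡n j (j * t))))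

crossing : {P : ℕ → Set} → Decidable P → ∀ t → ¬ P 0 → P t → ∃[ i ] ¬ P i × P (suc i)
crossing P? zero    ¬P0 P0 = ⊥-elim (¬P0 P0)
crossing P? (suc t) ¬P0 P[1+t] with P? t
... | yes Pt = crossing P? t ¬P0 Pt
... | no ¬Pt = t , ¬Pt , P[1+t]

between-fourth-powers : ∀ B → 1 ≤ B → ∃[ i ] ¬ B ≤ i ^ 4 × B ≤ suc i ^ 4
between-fourth-powers B 1≤B = crossing (λ i → B ≤? i ^ 4) B (λ B≤0 → <⇒≱ 1≤B B≤0) (m≤m*n B (B ^ 3) {{>-nonZero (m^n>0 B {{>-nonZero 1≤B}} 3)}})

n^4≤2^n : ∀ n → 16 ≤ n → n ^ 4 ≤ 2 ^ n
n^4≤2^n n 16≤n = subst (λ k → k ^ 4 ≤ 2 ^ k) (m∸n+n≡m 16≤n) (shifted (n ∸ 16))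
  where
  -- The ring solver does not handle _^_, hence the expanded fourth powers.
  slack : ∀ d → (1 + d + 16) * ((1 + d + 16) * ((1 + d + 16) * ((1 + d + 16) * 1)))
                + (d * (d * (d * (d * 1))) + 60 * (d * (d * (d * 1))) + 1338 * (d * (d * 1)) + 13116 * d + 47551)
              ≡ 2 * ((d + 16) * ((d + 16) * ((d + 16) * ((d + 16) * 1))))
  slack = solve-∀
  shifted : ∀ d → (d + 16) ^ 4 ≤ 2 ^ (d + 16)
  shifted zero    = ≤-refl
  shifted (suc d) = ≤-trans (≤-trans (m≤m+n _ _) (≤-reflexive (slack d))) (*-monoʳ-≤ 2 (shifted d))

module ParameterChoice (μ M i : ℕ) (1≤μ : 1 ≤ μ) (2^16≤M : 2 ^ 16 ≤ M)
                       (i-small : ¬ μ * (2 * M) ≤ i ^ 4) (j-large : μ * (2 * M) ≤ suc i ^ 4) where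

  private
    j = suc i

    M<μ[2M] : M < μ * (2 * M)
    M<μ[2M] = <-≤-trans (m<n+m M (≤-trans (m^n>0 2 16) 2^16≤M))
                        (≤-trans (≤-reflexive (cong (M +_) (sym (+-identityʳ M)))) (m≤n*m (2 * M) μ {{>-nonZero 1≤μ}}))

  16<j : 16 < j
  16<j = ≰⇒> λ j≤16 → <⇒≱ (≤-<-trans 2^16≤M M<μ[2M]) (≤-trans j-large (^-monoˡ-≤ 4 j≤16))

  M<2^j : M < 2 ^ j
  M<2^j = <-≤-trans M<μ[2M] (≤-trans j-large (n^4≤2^n j (<⇒≤ 16<j)))

  -- N = 0 suffices: the bound holds even without the factor e².
  within-bound : (4 * j) ^ 4 * 0 ! ≤ 2 ^ 11 * μ * M * T 0
  within-bound = begin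
    (4 * j) ^ 4 * 1         ≡⟨ expand j ⟩
    256 * j ^ 4             ≤⟨ *-monoʳ-≤ 256 j^4≤8μM ⟩
    256 * (8 * (μ * M))     ≡⟨ collect μ M ⟩
    2 ^ 11 * μ * M * 1      ∎
    where
    open ≤-Reasoning
    expand : ∀ j → (4 * j) * ((4 * j) * ((4 * j) * ((4 * j) * 1))) * 1 ≡ 256 * (j * (j * (j * (j * 1))))
    expand = solve-∀
    collect : ∀ μ M → 256 * (8 * (μ * M)) ≡ 2048 * μ * M * 1
    collect = solve-∀
    3j≤4i : 3 * j ≤ 4 * i
    3j≤4i = ≤-trans (≤-reflexive (*-suc 3 i)) (+-monoˡ-≤ (3 * i) (≤-trans (s≤s (s≤s (s≤s z≤n))) (≤-pred 16<j)))
    j^4≤8μM : j ^ 4 ≤ 8 * (μ * M)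
    j^4≤8μM = *-cancelˡ-≤ 81 (begin
      81 * j ^ 4              ≡⟨ pow4-* 3 j ⟩
      (3 * j) ^ 4             ≤⟨ ^-monoˡ-≤ 4 3j≤4i ⟩
      (4 * i) ^ 4             ≡⟨ pow4-* 4 i ⟨
      256 * i ^ 4             ≤⟨ *-monoʳ-≤ 256 (<⇒≤ (≰⇒> i-small)) ⟩
      256 * (μ * (2 * M))     ≡⟨ rearrange μ M ⟩
      512 * (μ * M)           ≤⟨ *-monoˡ-≤ (μ * M) (m≤m+n 512 136) ⟩
      648 * (μ * M)           ≡⟨ *-assoc 81 8 (μ * M) ⟩
      81 * (8 * (μ * M))      ∎)
      where
      pow4-* : ∀ a x → a * a * a * a * (x * (x * (x * (x * 1)))) ≡ (a * x) * ((a * x) * ((a * x) * ((a * x) * 1)))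
      pow4-* = solve-∀
      rearrange : ∀ μ M → 256 * (μ * (2 * M)) ≡ 512 * (μ * M)
      rearrange = solve-∀

⟦_⟧ : ∀ {n} {P : Fin n → Set} → Decidable P → Subset n
⟦ P? ⟧ = tabulate (does ∘ P?)

∈⟦⟧⁺ : ∀ {n} {P : Fin n → Set} (P? : Decidable P) {x} → P x → x ∈ₛ ⟦ P? ⟧
∈⟦⟧⁺ P? {x} Px = lookup⇒[]= x _ (trans (lookup∘tabulate (does ∘ P?) x) (dec-true (P? x) Px))

∈⟦⟧⁻ : ∀ {n} {P : Fin n → Set} (P? : Decidable P) {x} → x ∈ₛ ⟦ P? ⟧ → P x
∈⟦⟧⁻ P? {x} x∈ with P? x | trans (sym (lookup∘tabulate (does ∘ P?) x)) ([]=⇒lookup x∈)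
... | yes Px | _  = Px
... | no  _  | ()

x∉p-x : ∀ {n} (p : Subset n) x → x ∉ₛ p - x
x∉p-x (_ ∷ p) zero    ()
x∉p-x (_ ∷ p) (suc x) (there x∈p-x) = x∉p-x p x x∈p-x

module Graph (G : Multigraph) where

  V : Set
  V = Fin (n G)

  vertices : List V
  vertices = allFin (n G)

  edges : List (Fin (m G))
  edges = allFin (m G)

  end₁ end₂ : Fin (m G) → V
  end₁ e = proj₁ (ends G e)
  end₂ e = proj₂ (ends G e)

  multiplicity≡∑ : ∀ u v → multiplicity G u v ≡ ∑ edges (𝟙 ∘ joins? G u v)
  multiplicity≡∑ u v = countL≡∑𝟙 (joins? G u v) edges

  degree : V → ℕ
  degree v = ∑ vertices λ u → multiplicity G u v

  degreeIn : Subset (n G) → V → ℕ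
  degreeIn R v = ∑ vertices λ w → 𝟙 (w ∈? R) * multiplicity G w v

  degreeIn≤degree : ∀ R v → degreeIn R v ≤ degree v
  degreeIn≤degree R v = ∑-mono vertices λ w _ → ≤-trans (*-monoˡ-≤ _ (𝟙≤1 (w ∈? R))) (≤-reflexive (+-identityʳ _))

  ∑-𝟙≟ᶠ : ∀ x c → ∑ vertices (λ y → 𝟙 (y ≟ᶠ x) * c) ≤ c
  ∑-𝟙≟ᶠ x c = ∑-𝟙≡-unique _≟ᶠ_ vertices (allFin⁺ (n G)) x (λ _ → c)

  𝟙joins≤ : ∀ u v e → 𝟙 (joins? G u v e) ≤ 𝟙 (u ≟ᶠ end₁ e) * 𝟙 (v ≟ᶠ end₂ e) + 𝟙 (u ≟ᶠ end₂ e) * 𝟙 (v ≟ᶠ end₁ e)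
  𝟙joins≤ u v e with joins? G u v e
  ... | no _ = z≤n
  ... | yes (inj₁ (refl , refl)) rewrite 𝟙-yes (u ≟ᶠ u) refl | 𝟙-yes (v ≟ᶠ v) refl = s≤s z≤n
  ... | yes (inj₂ (refl , refl)) rewrite 𝟙-yes (u ≟ᶠ u) refl | 𝟙-yes (v ≟ᶠ v) refl =
        m≤n+m 1 (𝟙 (u ≟ᶠ v) * 𝟙 (v ≟ᶠ u))

  incidences≤2 : ∀ e → ∑ vertices (λ v → ∑ vertices (λ u → 𝟙 (joins? G u v e))) ≤ 2
  incidences≤2 e = begin
    ∑ vertices (λ v → ∑ vertices (λ u → 𝟙 (joins? G u v e)))
      ≤⟨ ∑-mono vertices (λ v _ → ∑-mono vertices (λ u _ → 𝟙joins≤ u v e)) ⟩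
    ∑ vertices (λ v → ∑ vertices (λ u → 𝟙 (u ≟ᶠ a) * 𝟙 (v ≟ᶠ b) + 𝟙 (u ≟ᶠ b) * 𝟙 (v ≟ᶠ a)))
      ≡⟨ ∑-cong vertices (λ v _ → ∑-distrib-+ vertices _ _) ⟩
    ∑ vertices (λ v → ∑ vertices (λ u → 𝟙 (u ≟ᶠ a) * 𝟙 (v ≟ᶠ b)) + ∑ vertices (λ u → 𝟙 (u ≟ᶠ b) * 𝟙 (v ≟ᶠ a)))
      ≤⟨ ∑-mono vertices (λ v _ → +-mono-≤ (∑-𝟙≟ᶠ a _) (∑-𝟙≟ᶠ b _)) ⟩
    ∑ vertices (λ v → 𝟙 (v ≟ᶠ b) + 𝟙 (v ≟ᶠ a))
      ≡⟨ ∑-distrib-+ vertices _ _ ⟩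
    ∑ vertices (λ v → 𝟙 (v ≟ᶠ b)) + ∑ vertices (λ v → 𝟙 (v ≟ᶠ a))
      ≡⟨ cong₂ _+_ (∑-cong vertices (λ v _ → sym (*-identityʳ _))) (∑-cong vertices (λ v _ → sym (*-identityʳ _))) ⟩
    ∑ vertices (λ v → 𝟙 (v ≟ᶠ b) * 1) + ∑ vertices (λ v → 𝟙 (v ≟ᶠ a) * 1)
      ≤⟨ +-mono-≤ (∑-𝟙≟ᶠ b 1) (∑-𝟙≟ᶠ a 1) ⟩
    2 ∎
    where
    open ≤-Reasoning
    a = end₁ e
    b = end₂ e

  handshake : ∑ vertices degree ≤ 2 * m G
  handshake = begin
    ∑ vertices (λ v → ∑ vertices (λ u → multiplicity G u v))
      ≡⟨ ∑-cong vertices (λ v _ → ∑-cong vertices (λ u _ → multiplicity≡∑ u v)) ⟩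
    ∑ vertices (λ v → ∑ vertices (λ u → ∑ edges (λ e → 𝟙 (joins? G u v e))))
      ≡⟨ ∑-cong vertices (λ v _ → ∑-comm vertices edges _) ⟩
    ∑ vertices (λ v → ∑ edges (λ e → ∑ vertices (λ u → 𝟙 (joins? G u v e))))
      ≡⟨ ∑-comm vertices edges _ ⟩
    ∑ edges (λ e → ∑ vertices (λ v → ∑ vertices (λ u → 𝟙 (joins? G u v e))))
      ≤⟨ ∑-mono edges (λ e _ → incidences≤2 e) ⟩
    ∑ edges (λ _ → 2)
      ≡⟨ trans (∑-const edges 2) (trans (cong (_* 2) (length-tabulate {n = m G} id)) (*-comm (m G) 2)) ⟩
    2 * m G ∎
    where open ≤-Reasoning

module Counting (G : Multigraph) (ℓ : Fin (m G) → ℕ) (ℓ-pos : IsLabelling G ℓ) where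

  open Graph G

  -- A vector colouring uses colour 0 for "uncoloured": labels are positive, so a vertex of colour 0 is in no conflict.
  Colouring : Set
  Colouring = Vec ℕ (n G)

  Conflict : Colouring → Fin (m G) → Set
  Conflict c e = lookup c (end₁ e) ≡ ℓ e × lookup c (end₂ e) ≡ ℓ e

  conflict? : ∀ c e → Dec (Conflict c e)
  conflict? c e = (lookup c (end₁ e) ≟ ℓ e) ×-dec (lookup c (end₂ e) ≟ ℓ e)

  adapted? : (c : Colouring) → Dec (Adapted G ℓ (lookup c))
  adapted? c = all? (¬? ∘ conflict? c)

  good : Colouring → ℕ
  good c = 𝟙 (adapted? c)

  conflict : ∀ c → ¬ Adapted G ℓ (lookup c) → ∃[ e ] Conflict c e
  conflict c ¬adapted with ¬∀⟶∃¬ (m G) _ (¬? ∘ conflict? c) ¬adapted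
  ... | e , ¬¬conflict = e , decidable-stable (conflict? c e) ¬¬conflict

  adapted-update⁻ : ∀ c {w} y → lookup c w ≡ 0 → Adapted G ℓ (lookup (c [ w ]≔ y)) → Adapted G ℓ (lookup c)
  adapted-update⁻ c {w} y cw≡0 adapted′ e (c₁≡ℓ , c₂≡ℓ) = adapted′ e (unchanged c₁≡ℓ , unchanged c₂≡ℓ)
    where
    unchanged : ∀ {x} → lookup c x ≡ ℓ e → lookup (c [ w ]≔ y) x ≡ ℓ e
    unchanged {x} cx≡ℓ = trans (lookup∘update′ x≢w c y) cx≡ℓ
      where
      x≢w : x ≢ w
      x≢w refl = <⇒≢ (ℓ-pos e) (trans (sym cw≡0) cx≡ℓ)

  good-update≤ : ∀ c {w} y → lookup c w ≡ 0 → good (c [ w ]≔ y) ≤ good c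
  good-update≤ c {w} y cw≡0 = 𝟙-mono (adapted-update⁻ c y cw≡0) (adapted? (c [ w ]≔ y)) (adapted? c)

  conflictsAt : Colouring → V → ℕ → ℕ
  conflictsAt c u y = ∑ vertices λ w → ∑ edges λ e →
    𝟙 (joins? G w u e) * (𝟙 (y ≟ ℓ e) * (good c * 𝟙 (lookup c w ≟ y)))

  conflictsAt-pos : ∀ c {u y w e} → Joins G w u e → y ≡ ℓ e → Adapted G ℓ (lookup c) → lookup c w ≡ y →
                    1 ≤ conflictsAt c u y
  conflictsAt-pos c {u} {y} {w} {e} joins y≡ℓ adapted cw≡y = begin
    1                                      ≡⟨ term≡1 ⟨
    term w e                               ≤⟨ ∈⇒≤∑ edges (term w) (∈-allFin e) ⟩
    ∑ edges (term w)                       ≤⟨ ∈⇒≤∑ vertices (λ w′ → ∑ edges (term w′)) (∈-allFin w) ⟩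
    conflictsAt c u y                      ∎
    where
    open ≤-Reasoning
    term : V → Fin (m G) → ℕ
    term w e = 𝟙 (joins? G w u e) * (𝟙 (y ≟ ℓ e) * (good c * 𝟙 (lookup c w ≟ y)))
    term≡1 : term w e ≡ 1
    term≡1 rewrite 𝟙-yes (joins? G w u e) joins | 𝟙-yes (y ≟ ℓ e) y≡ℓ
                 | 𝟙-yes (adapted? c) adapted | 𝟙-yes (lookup c w ≟ y) cw≡y = refl

  good≤good-update+conflictsAt : ∀ c u y → good c ≤ good (c [ u ]≔ y) + conflictsAt c u y
  good≤good-update+conflictsAt c u y = by-cases (adapted? c) (adapted? (c [ u ]≔ y))
    where
    by-cases : (a : Dec (Adapted G ℓ (lookup c))) (a′ : Dec (Adapted G ℓ (lookup (c [ u ]≔ y)))) →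
               𝟙 a ≤ 𝟙 a′ + conflictsAt c u y
    by-cases (no _)       _              = z≤n
    by-cases (yes _)      (yes _)        = s≤s z≤n
    by-cases (yes adapted) (no ¬adapted′) with conflict (c [ u ]≔ y) ¬adapted′
    ... | e , c₁≡ℓ , c₂≡ℓ with end₁ e ≟ᶠ u | end₂ e ≟ᶠ u
    ...   | yes refl | yes e₂≡u = ⊥-elim (loopless G e (sym e₂≡u))
    ...   | yes refl | no  e₂≢u =
            conflictsAt-pos c (inj₂ (refl , refl)) y≡ℓ adapted (trans (sym (lookup∘update′ e₂≢u c y)) (trans c₂≡ℓ (sym y≡ℓ)))
      where
      y≡ℓ : y ≡ ℓ e
      y≡ℓ = trans (sym (lookup∘update (end₁ e) c y)) c₁≡ℓ
    ...   | no  e₁≢u | yes refl =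
            conflictsAt-pos c (inj₁ (refl , refl)) y≡ℓ adapted (trans (sym (lookup∘update′ e₁≢u c y)) (trans c₁≡ℓ (sym y≡ℓ)))
      where
      y≡ℓ : y ≡ ℓ e
      y≡ℓ = trans (sym (lookup∘update (end₂ e) c y)) c₂≡ℓ
    ...   | no  e₁≢u | no  e₂≢u =
            ⊥-elim (adapted e (trans (sym (lookup∘update′ e₁≢u c y)) c₁≡ℓ , trans (sym (lookup∘update′ e₂≢u c y)) c₂≡ℓ))

  restrict : (V → List ℕ) → Subset (n G) → V → List ℕ
  restrict A S w = if does (w ∈? S) then A w else 0 ∷ []

  restrict-∈ : ∀ A {S w} → w ∈ₛ S → restrict A S w ≡ A w
  restrict-∈ A {S} {w} w∈S rewrite dec-true (w ∈? S) w∈S = refl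

  restrict-∉ : ∀ A {S w} → w ∉ₛ S → restrict A S w ≡ 0 ∷ []
  restrict-∉ A {S} {w} w∉S rewrite dec-false (w ∈? S) w∉S = refl

  ∈ᶜ-restrict-∉ : ∀ A {S w} c → c ∈ᶜ restrict A S → w ∉ₛ S → lookup c w ≡ 0
  ∈ᶜ-restrict-∉ A {S} {w} c c∈ w∉S = singleton⁻ (subst (lookup c w ∈_) (restrict-∉ A w∉S) (c∈ w))

  ∑ᶜ-restrict-split : ∀ A {T u} (f : Colouring → ℕ) → u ∈ₛ T →
                      ∑ᶜ (restrict A T) f ≡ ∑ (A u) λ y → ∑ᶜ (restrict A (T - u)) (λ c → f (c [ u ]≔ y))
  ∑ᶜ-restrict-split A {T} {u} f u∈T =
    trans (∑ᶜ-split (restrict A T) (restrict A (T - u)) u 0 f unchanged (restrict-∉ A (x∉p-x T u)))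
          (cong (λ xs → ∑ xs λ y → ∑ᶜ (restrict A (T - u)) (λ c → f (c [ u ]≔ y))) (restrict-∈ A u∈T))
    where
    unchanged : ∀ w → w ≢ u → restrict A (T - u) w ≡ restrict A T w
    unchanged w w≢u = by-cases (w ∈? T)
      where
      by-cases : Dec (w ∈ₛ T) → restrict A (T - u) w ≡ restrict A T w
      by-cases (yes w∈T) = trans (restrict-∈ A (x∈p∧x≢y⇒x∈p-y w∈T w≢u)) (sym (restrict-∈ A w∈T))
      by-cases (no  w∉T) = trans (restrict-∉ A (w∉T ∘ p─q⊆p T _)) (sym (restrict-∉ A w∉T))

  ∑ᶜ-pin : ∀ A {T u} x (h : Colouring → ℕ) → u ∈ₛ T → Unique (A u) → (∀ c y → h (c [ u ]≔ y) ≡ h c) →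
           ∑ᶜ (restrict A T) (λ c → good c * (𝟙 (lookup c u ≟ x) * h c)) ≤ ∑ᶜ (restrict A (T - u)) (λ c → good c * h c)
  ∑ᶜ-pin A {T} {u} x h u∈T unique-u h-update = begin
    ∑ᶜ (restrict A T) (λ c → good c * (𝟙 (lookup c u ≟ x) * h c))
      ≡⟨ ∑ᶜ-restrict-split A (λ c → good c * (𝟙 (lookup c u ≟ x) * h c)) u∈T ⟩
    ∑ (A u) (λ y → ∑ᶜ (restrict A (T - u)) (λ c → good (c [ u ]≔ y) * (𝟙 (lookup (c [ u ]≔ y) u ≟ x) * h (c [ u ]≔ y))))
      ≤⟨ ∑-mono (A u) (λ y _ → ∑ᶜ-mono (restrict A (T - u)) (pointwise y)) ⟩
    ∑ (A u) (λ y → ∑ᶜ (restrict A (T - u)) (λ c → 𝟙 (y ≟ x) * (good c * h c)))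
      ≡⟨ ∑-cong (A u) (λ y _ → ∑ᶜ-*ˡ (restrict A (T - u)) (𝟙 (y ≟ x)) _) ⟩
    ∑ (A u) (λ y → 𝟙 (y ≟ x) * ∑ᶜ (restrict A (T - u)) (λ c → good c * h c))
      ≤⟨ ∑-𝟙≡-unique _≟_ (A u) unique-u x _ ⟩
    ∑ᶜ (restrict A (T - u)) (λ c → good c * h c) ∎
    where
    open ≤-Reasoning
    pointwise : ∀ y c → c ∈ᶜ restrict A (T - u) →
                good (c [ u ]≔ y) * (𝟙 (lookup (c [ u ]≔ y) u ≟ x) * h (c [ u ]≔ y)) ≤ 𝟙 (y ≟ x) * (good c * h c)
    pointwise y c c∈ rewrite lookup∘update u c y | h-update c y =
      ≤-trans (*-monoˡ-≤ _ (good-update≤ c y (∈ᶜ-restrict-∉ A c c∈ (x∉p-x T u))))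
              (≤-reflexive (*-CS.x∙yz≈y∙xz (good c) (𝟙 (y ≟ x)) (h c)))

  adaptedCount : (V → List ℕ) → Subset (n G) → ℕ
  adaptedCount A S = ∑ᶜ (restrict A S) good

  neighbourCount : (V → List ℕ) → Subset (n G) → V → ℕ
  neighbourCount A S u = ∑ vertices (λ w → multiplicity G w u * (𝟙 (w ∈? S) * adaptedCount A (S - w)))

  colouredWith : (V → List ℕ) → Subset (n G) → V → ℕ → ℕ
  colouredWith A S w x = ∑ᶜ (restrict A S) (λ c → good c * 𝟙 (lookup c w ≟ x))

  colouredWith≤ : ∀ A S w {x} → 1 ≤ x → (w ∈ₛ S → Unique (A w)) →
                  colouredWith A S w x ≤ 𝟙 (w ∈? S) * adaptedCount A (S - w)
  colouredWith≤ A S w {x} 1≤x unique with w ∈? S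
  ... | no w∉S = ≤-reflexive (trans (∑ᶜ-cong (restrict A S) vanish) (∑ᶜ-zero (restrict A S)))
    where
    vanish : ∀ c → c ∈ᶜ restrict A S → good c * 𝟙 (lookup c w ≟ x) ≡ 0
    vanish c c∈ = trans (cong (good c *_) (𝟙-no (lookup c w ≟ x) λ cw≡x → <⇒≢ 1≤x (trans (sym (∈ᶜ-restrict-∉ A c c∈ w∉S)) cw≡x)))
                        (*-zeroʳ (good c))
  ... | yes w∈S = begin
    colouredWith A S w x
      ≡⟨ ∑ᶜ-cong (restrict A S) (λ c _ → cong (good c *_) (sym (*-identityʳ _))) ⟩
    ∑ᶜ (restrict A S) (λ c → good c * (𝟙 (lookup c w ≟ x) * 1))
      ≤⟨ ∑ᶜ-pin A x (λ _ → 1) w∈S (unique w∈S) (λ _ _ → refl) ⟩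
    ∑ᶜ (restrict A (S - w)) (λ c → good c * 1)
      ≡⟨ ∑ᶜ-cong (restrict A (S - w)) (λ c _ → *-identityʳ (good c)) ⟩
    adaptedCount A (S - w)
      ≡⟨ *-identityˡ _ ⟨
    1 * adaptedCount A (S - w) ∎
    where open ≤-Reasoning

  ∑ᶜ-conflictsAt : ∀ A S u y → ∑ᶜ (restrict A S) (λ c → conflictsAt c u y) ≡
                   ∑ vertices λ w → ∑ edges λ e → 𝟙 (joins? G w u e) * (𝟙 (y ≟ ℓ e) * colouredWith A S w y)
  ∑ᶜ-conflictsAt A S u y =
    trans (∑ᶜ-∑ (restrict A S) vertices _) (∑-cong vertices λ w _ →
      trans (∑ᶜ-∑ (restrict A S) edges _) (∑-cong edges λ e _ →
        trans (∑ᶜ-*ˡ (restrict A S) (𝟙 (joins? G w u e)) _)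
              (cong (𝟙 (joins? G w u e) *_) (∑ᶜ-*ˡ (restrict A S) (𝟙 (y ≟ ℓ e)) _))))

  ∑-∑ᶜ-conflictsAt≤ : ∀ A S u → Unique (A u) → (∀ {w} → w ∈ₛ S → Unique (A w)) →
                      ∑ (A u) (λ y → ∑ᶜ (restrict A S) (λ c → conflictsAt c u y))
                        ≤ neighbourCount A S u
  ∑-∑ᶜ-conflictsAt≤ A S u unique-u unique = begin
    ∑ (A u) (λ y → ∑ᶜ (restrict A S) (λ c → conflictsAt c u y))
      ≡⟨ ∑-cong (A u) (λ y _ → ∑ᶜ-conflictsAt A S u y) ⟩
    ∑ (A u) (λ y → ∑ vertices λ w → ∑ edges λ e → joinsᵘ w e * (𝟙 (y ≟ ℓ e) * colouredWith A S w y))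
      ≡⟨ ∑-comm (A u) vertices _ ⟩
    ∑ vertices (λ w → ∑ (A u) λ y → ∑ edges λ e → joinsᵘ w e * (𝟙 (y ≟ ℓ e) * colouredWith A S w y))
      ≡⟨ ∑-cong vertices (λ w _ → ∑-comm (A u) edges _) ⟩
    ∑ vertices (λ w → ∑ edges λ e → ∑ (A u) λ y → joinsᵘ w e * (𝟙 (y ≟ ℓ e) * colouredWith A S w y))
      ≡⟨ ∑-cong vertices (λ w _ → ∑-cong edges (λ e _ → ∑-*ˡ (A u) (joinsᵘ w e) _)) ⟩
    ∑ vertices (λ w → ∑ edges λ e → joinsᵘ w e * ∑ (A u) λ y → 𝟙 (y ≟ ℓ e) * colouredWith A S w y)
      ≤⟨ ∑-mono vertices (λ w _ → ∑-mono edges (λ e _ → *-monoʳ-≤ (joinsᵘ w e) (≤-trans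
           (∑-𝟙≡-unique _≟_ (A u) unique-u (ℓ e) (colouredWith A S w))
           (colouredWith≤ A S w (ℓ-pos e) unique)))) ⟩
    ∑ vertices (λ w → ∑ edges λ e → joinsᵘ w e * (𝟙 (w ∈? S) * adaptedCount A (S - w)))
      ≡⟨ ∑-cong vertices (λ w _ → trans (∑-*ʳ edges _ (joinsᵘ w)) (cong (_* _) (sym (multiplicity≡∑ w u)))) ⟩
    neighbourCount A S u ∎
    where
    open ≤-Reasoning
    joinsᵘ : V → Fin (m G) → ℕ
    joinsᵘ w e = 𝟙 (joins? G w u e)

  extension-count : ∀ A {T u} → u ∈ₛ T → Unique (A u) → (∀ {w} → w ∈ₛ T - u → Unique (A w)) →
                    length (A u) * adaptedCount A (T - u)
                      ≤ adaptedCount A T + neighbourCount A (T - u) u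
  extension-count A {T} {u} u∈T unique-u unique = begin
    length (A u) * adaptedCount A S
      ≡⟨ ∑-const (A u) _ ⟨
    ∑ (A u) (λ _ → ∑ᶜ (restrict A S) good)
      ≤⟨ ∑-mono (A u) (λ y _ → ∑ᶜ-mono (restrict A S) (λ c _ → good≤good-update+conflictsAt c u y)) ⟩
    ∑ (A u) (λ y → ∑ᶜ (restrict A S) (λ c → good (c [ u ]≔ y) + conflictsAt c u y))
      ≡⟨ ∑-cong (A u) (λ y _ → ∑ᶜ-distrib-+ (restrict A S) _ _) ⟩
    ∑ (A u) (λ y → ∑ᶜ (restrict A S) (λ c → good (c [ u ]≔ y)) + ∑ᶜ (restrict A S) (λ c → conflictsAt c u y))
      ≡⟨ ∑-distrib-+ (A u) _ _ ⟩
    ∑ (A u) (λ y → ∑ᶜ (restrict A S) (λ c → good (c [ u ]≔ y))) + ∑ (A u) (λ y → ∑ᶜ (restrict A S) (λ c → conflictsAt c u y))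
      ≤⟨ +-mono-≤ (≤-reflexive (sym (∑ᶜ-restrict-split A good u∈T))) (∑-∑ᶜ-conflictsAt≤ A S u unique-u unique) ⟩
    adaptedCount A T + neighbourCount A S u ∎
    where
    open ≤-Reasoning
    S = T - u

  adaptedCount-empty : ∀ A {T} → (∀ w → w ∉ₛ T) → adaptedCount A T ≡ 1
  adaptedCount-empty A {T} empty =
    trans (∑ᶜ-singletons (restrict A T) 0 good (λ w → restrict-∉ A (empty w))) (𝟙-yes (adapted? (replicate (n G) 0)) uncoloured)
    where
    uncoloured : Adapted G ℓ (lookup (replicate (n G) 0))
    uncoloured e (c₁≡ℓ , _) = <⇒≢ (ℓ-pos e) (trans (sym (lookup-replicate (end₁ e) 0)) c₁≡ℓ)

  Blocks : V → ℕ → V → Set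
  Blocks u x v = ∃[ e ] Joins G u v e × ℓ e ≡ x

  blocks? : ∀ u x v → Dec (Blocks u x v)
  blocks? u x v = any? λ e → joins? G u v e ×-dec (ℓ e ≟ x)

  blockers : V → Colouring → List V → ℕ
  blockers v c us = ∑ us λ u → 𝟙 (blocks? u (lookup c u) v)

  blockers-update : ∀ v c {u} y us → All.All (u ≢_) us → blockers v (c [ u ]≔ y) us ≡ blockers v c us
  blockers-update v c y []       _            = refl
  blockers-update v c y (w ∷ us) (u≢w All.∷ u≢us) =
    cong₂ _+_ (cong (λ x → 𝟙 (blocks? w x v)) (lookup∘update′ (u≢w ∘ sym) c y)) (blockers-update v c y us u≢us)

  𝟙blocks≤multiplicity : ∀ u x v → 𝟙 (blocks? u x v) ≤ multiplicity G u v
  𝟙blocks≤multiplicity u x v with blocks? u x v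
  ... | no  _              = z≤n
  ... | yes (e , joins , _) = begin
    1                                 ≡⟨ 𝟙-yes (joins? G u v e) joins ⟨
    𝟙 (joins? G u v e)                ≤⟨ ∈⇒≤∑ edges (𝟙 ∘ joins? G u v) (∈-allFin e) ⟩
    ∑ edges (𝟙 ∘ joins? G u v)        ≡⟨ multiplicity≡∑ u v ⟨
    multiplicity G u v                ∎
    where open ≤-Reasoning

  blockers≤degree : ∀ v c → blockers v c vertices ≤ degree v
  blockers≤degree v c = ∑-mono vertices (λ u _ → 𝟙blocks≤multiplicity u (lookup c u) v)

  𝟙blocks≤∑ : ∀ u x v → 𝟙 (blocks? u x v) ≤ ∑ edges (λ e → 𝟙 (joins? G u v e) * 𝟙 (x ≟ ℓ e))
  𝟙blocks≤∑ u x v with blocks? u x v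
  ... | no  _                  = z≤n
  ... | yes (e , joins , ℓe≡x) = begin
    1                                                    ≡⟨ term≡1 ⟨
    𝟙 (joins? G u v e) * 𝟙 (x ≟ ℓ e)                     ≤⟨ ∈⇒≤∑ edges (λ e → 𝟙 (joins? G u v e) * 𝟙 (x ≟ ℓ e)) (∈-allFin e) ⟩
    ∑ edges (λ e → 𝟙 (joins? G u v e) * 𝟙 (x ≟ ℓ e))    ∎
    where
    open ≤-Reasoning
    term≡1 : 𝟙 (joins? G u v e) * 𝟙 (x ≟ ℓ e) ≡ 1
    term≡1 rewrite 𝟙-yes (joins? G u v e) joins | 𝟙-yes (x ≟ ℓ e) (sym ℓe≡x) = refl

  weighted : (V → List ℕ) → V → Subset (n G) → List V → ℕ
  weighted A v T us = ∑ᶜ (restrict A T) λ c → good c * 2 ^ blockers v c us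

  blockedBy : (V → List ℕ) → V → Subset (n G) → V → List V → ℕ
  blockedBy A v T u us = ∑ᶜ (restrict A T) λ c → good c * (𝟙 (blocks? u (lookup c u) v) * 2 ^ blockers v c us)

  weighted-∷ : ∀ A v T u us → weighted A v T (u ∷ us) ≡ weighted A v T us + blockedBy A v T u us
  weighted-∷ A v T u us = trans (∑ᶜ-cong (restrict A T) λ c _ →
      trans (cong (good c *_) (2^[𝟙+n] (blocks? u (lookup c u) v) (blockers v c us))) (*-distribˡ-+ (good c) _ _))
    (∑ᶜ-distrib-+ (restrict A T) _ _)

  blockedBy-∉ : ∀ A v {T u} us → u ∉ₛ T → blockedBy A v T u us ≡ 0
  blockedBy-∉ A v {T} {u} us u∉T = trans (∑ᶜ-cong (restrict A T) vanish) (∑ᶜ-zero (restrict A T))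
    where
    vanish : ∀ c → c ∈ᶜ restrict A T → good c * (𝟙 (blocks? u (lookup c u) v) * 2 ^ blockers v c us) ≡ 0
    vanish c c∈ rewrite ∈ᶜ-restrict-∉ A c c∈ u∉T
                      | 𝟙-no (blocks? u 0 v) (λ { (e , _ , ℓe≡0) → <⇒≢ (ℓ-pos e) (sym ℓe≡0) }) = *-zeroʳ (good c)

  blockedBy-∈ : ∀ A v {T u} us → u ∈ₛ T → Unique (A u) → All.All (u ≢_) us →
                blockedBy A v T u us ≤ multiplicity G u v * weighted A v (T - u) us
  blockedBy-∈ A v {T} {u} us u∈T unique-u u∉us = begin
    blockedBy A v T u us
      ≤⟨ ∑ᶜ-mono (restrict A T) (λ c _ → *-monoʳ-≤ (good c) (*-monoˡ-≤ (2 ^ blockers v c us) (𝟙blocks≤∑ u (lookup c u) v))) ⟩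
    ∑ᶜ (restrict A T) (λ c → good c * (∑ edges (λ e → 𝟙 (joins? G u v e) * 𝟙 (lookup c u ≟ ℓ e)) * 2 ^ blockers v c us))
      ≡⟨ ∑ᶜ-cong (restrict A T) (λ c _ → distribute c) ⟩
    ∑ᶜ (restrict A T) (λ c → ∑ edges (λ e → 𝟙 (joins? G u v e) * F e c))
      ≡⟨ ∑ᶜ-∑ (restrict A T) edges _ ⟩
    ∑ edges (λ e → ∑ᶜ (restrict A T) (λ c → 𝟙 (joins? G u v e) * F e c))
      ≡⟨ ∑-cong edges (λ e _ → ∑ᶜ-*ˡ (restrict A T) (𝟙 (joins? G u v e)) (F e)) ⟩
    ∑ edges (λ e → 𝟙 (joins? G u v e) * ∑ᶜ (restrict A T) (F e))
      ≤⟨ ∑-mono edges (λ e _ → *-monoʳ-≤ (𝟙 (joins? G u v e))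
           (∑ᶜ-pin A (ℓ e) (λ c → 2 ^ blockers v c us) u∈T unique-u (λ c y → cong (2 ^_) (blockers-update v c y us u∉us)))) ⟩
    ∑ edges (λ e → 𝟙 (joins? G u v e) * weighted A v (T - u) us)
      ≡⟨ trans (∑-*ʳ edges _ _) (cong (_* weighted A v (T - u) us) (sym (multiplicity≡∑ u v))) ⟩
    multiplicity G u v * weighted A v (T - u) us ∎
    where
    open ≤-Reasoning
    F : Fin (m G) → Colouring → ℕ
    F e c = good c * (𝟙 (lookup c u ≟ ℓ e) * 2 ^ blockers v c us)
    distribute : ∀ c → good c * (∑ edges (λ e → 𝟙 (joins? G u v e) * 𝟙 (lookup c u ≟ ℓ e)) * 2 ^ blockers v c us)
                       ≡ ∑ edges (λ e → 𝟙 (joins? G u v e) * F e c)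
    distribute c = trans (cong (good c *_) (sym (∑-*ʳ edges _ _))) (trans (sym (∑-*ˡ edges (good c) _))
                     (∑-cong edges (λ e _ → regroup (good c) (𝟙 (joins? G u v e)) _ _)))
      where
      regroup : ∀ g a b p → g * (a * b * p) ≡ a * (g * (b * p))
      regroup = solve-∀

  module Sparse (A : V → List ℕ) (R : Subset (n G)) (κ : ℕ) (1≤κ : 1 ≤ κ)
                (long : ∀ {v} → v ∈ₛ R → κ ≤ length (A v))
                (unique : ∀ {v} → v ∈ₛ R → Unique (A v))
                (sparse : ∀ {v} → v ∈ₛ R → 4 * degreeIn R v ≤ κ * κ) where

    neighbours-bound : ∀ {S u} → S ⊆ R → (∀ {w} → w ∈ₛ S → κ * adaptedCount A (S - w) ≤ 2 * adaptedCount A S) →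
                       κ * neighbourCount A S u ≤ 2 * adaptedCount A S * degreeIn R u
    neighbours-bound {S} {u} S⊆R ratio = begin
      κ * neighbourCount A S u
        ≡⟨ ∑-*ˡ vertices κ _ ⟨
      ∑ vertices (λ w → κ * (multiplicity G w u * (𝟙 (w ∈? S) * adaptedCount A (S - w))))
        ≤⟨ ∑-mono vertices (λ w _ → pointwise w (w ∈? S)) ⟩
      ∑ vertices (λ w → 2 * adaptedCount A S * (𝟙 (w ∈? R) * multiplicity G w u))
        ≡⟨ ∑-*ˡ vertices (2 * adaptedCount A S) _ ⟩
      2 * adaptedCount A S * degreeIn R u ∎
      where
      open ≤-Reasoning
      pointwise : ∀ w (d : Dec (w ∈ₛ S)) → κ * (multiplicity G w u * (𝟙 d * adaptedCount A (S - w)))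
                                            ≤ 2 * adaptedCount A S * (𝟙 (w ∈? R) * multiplicity G w u)
      pointwise w (no _) rewrite *-zeroʳ (multiplicity G w u) | *-zeroʳ κ = z≤n
      pointwise w (yes w∈S) rewrite 𝟙-yes (w ∈? R) (S⊆R w∈S) = begin
        κ * (multiplicity G w u * (1 * adaptedCount A (S - w)))  ≡⟨ cong (λ x → κ * (multiplicity G w u * x)) (*-identityˡ _) ⟩
        κ * (multiplicity G w u * adaptedCount A (S - w))        ≡⟨ *-CS.x∙yz≈y∙xz κ (multiplicity G w u) _ ⟩
        multiplicity G w u * (κ * adaptedCount A (S - w))        ≤⟨ *-monoʳ-≤ (multiplicity G w u) (ratio w∈S) ⟩
        multiplicity G w u * (2 * adaptedCount A S)              ≡⟨ *-comm (multiplicity G w u) _ ⟩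
        2 * adaptedCount A S * multiplicity G w u                ≡⟨ cong (2 * adaptedCount A S *_) (*-identityˡ _) ⟨
        2 * adaptedCount A S * (1 * multiplicity G w u)          ∎

    -- By extension-count and induction, κ·C(T - u) ≤ C(T) + (2/κ)·degreeIn R u·C(T - u),
    -- and 4·degreeIn R u ≤ κ² absorbs the last term.
    removal-ratio : ∀ r {T u} → ∣ T ∣ ≤ r → T ⊆ R → u ∈ₛ T → κ * adaptedCount A (T - u) ≤ 2 * adaptedCount A T
    removal-ratio zero    {T} {u} ∣T∣≤0   _   u∈T = ⊥-elim (n≮0 (<-≤-trans (x∈p⇒∣p-x∣<∣p∣ u∈T) ∣T∣≤0))
    removal-ratio (suc r) {T} {u} ∣T∣≤1+r T⊆R u∈T = *-cancelˡ-≤ κ {{>-nonZero 1≤κ}} (2a≤b+c⇒c≤a⇒a≤b doubled absorbed)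
      where
      S = T - u
      CT = adaptedCount A T
      CS = adaptedCount A S
      W = degreeIn R u
      S⊆R : S ⊆ R
      S⊆R = T⊆R ∘ p─q⊆p T _
      extension : κ * (κ * CS) ≤ κ * CT + 2 * CS * W
      extension = begin
        κ * (κ * CS)                  ≤⟨ *-monoʳ-≤ κ (*-monoˡ-≤ CS (long (T⊆R u∈T))) ⟩
        κ * (length (A u) * CS)       ≤⟨ *-monoʳ-≤ κ (extension-count A u∈T (unique (T⊆R u∈T)) (unique ∘ S⊆R)) ⟩
        κ * (CT + _)                  ≡⟨ *-distribˡ-+ κ CT _ ⟩
        κ * CT + κ * _                ≤⟨ +-monoʳ-≤ (κ * CT) (neighbours-bound S⊆R
                                           (removal-ratio r (≤-pred (≤-trans (x∈p⇒∣p-x∣<∣p∣ u∈T) ∣T∣≤1+r)) S⊆R)) ⟩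
        κ * CT + 2 * CS * W           ∎
        where open ≤-Reasoning
      doubled : 2 * (κ * (κ * CS)) ≤ κ * (2 * CT) + 4 * W * CS
      doubled = ≤-trans (*-monoʳ-≤ 2 extension) (≤-reflexive (rearrange κ CT CS W))
        where
        rearrange : ∀ κ CT CS W → 2 * (κ * CT + 2 * CS * W) ≡ κ * (2 * CT) + 4 * W * CS
        rearrange = solve-∀
      absorbed : 4 * W * CS ≤ κ * (κ * CS)
      absorbed = ≤-trans (*-monoˡ-≤ CS (sparse (T⊆R u∈T))) (≤-reflexive (*-assoc κ κ CS))

    adaptedCount-pos : ∀ r {T} → ∣ T ∣ ≤ r → T ⊆ R → 1 ≤ adaptedCount A T
    adaptedCount-pos r {T} ∣T∣≤r T⊆R with nonempty? T
    ... | no  empty   = ≤-reflexive (sym (adaptedCount-empty A (λ w w∈T → empty (w , w∈T))))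
    ... | yes (u , u∈T) = pos r ∣T∣≤r
      where
      pos : ∀ r → ∣ T ∣ ≤ r → 1 ≤ adaptedCount A T
      pos zero    ∣T∣≤0   = ⊥-elim (n≮0 (<-≤-trans (x∈p⇒∣p-x∣<∣p∣ u∈T) ∣T∣≤0))
      pos (suc r) ∣T∣≤1+r = 1≤2x⇒1≤x (≤-trans (*-mono-≤ 1≤κ IH) (removal-ratio (suc r) ∣T∣≤1+r T⊆R u∈T))
        where
        IH : 1 ≤ adaptedCount A (T - u)
        IH = adaptedCount-pos r (≤-pred (≤-trans (x∈p⇒∣p-x∣<∣p∣ u∈T) ∣T∣≤1+r)) (T⊆R ∘ p─q⊆p T _)
        1≤2x⇒1≤x : ∀ {x} → 1 ≤ 2 * x → 1 ≤ x
        1≤2x⇒1≤x {suc x} _ = s≤s z≤n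

    -- Opaque, since unfolding the witness would make Agda evaluate the counting argument.
    opaque
      adapted-choice : ∃[ c ] c ∈ᶜ restrict A R × Adapted G ℓ (lookup c)
      adapted-choice with ∑ᶜ<∑ᶜ⇒∃< (restrict A R) {λ _ → 0} {good}
                            (subst (_< adaptedCount A R) (sym (∑ᶜ-zero (restrict A R))) (adaptedCount-pos ∣ R ∣ ≤-refl id))
      ... | c , c∈ , 0<good = c , c∈ , 𝟙>0⇒ (adapted? c) 0<good

    weighted-bound : ∀ v us → Unique us → ∀ {T} → T ⊆ R →
                     κ ^ length us * weighted A v T us ≤ adaptedCount A T * ∏ us (λ u → κ + 2 * multiplicity G u v)
    weighted-bound v [] _ {T} _ = ≤-reflexive (begin-equality
      1 * weighted A v T []                  ≡⟨ *-identityˡ _ ⟩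
      ∑ᶜ (restrict A T) (λ c → good c * 1)   ≡⟨ ∑ᶜ-cong (restrict A T) (λ c _ → *-identityʳ (good c)) ⟩
      adaptedCount A T                       ≡⟨ *-identityʳ _ ⟨
      adaptedCount A T * 1                   ∎)
      where open ≤-Reasoning
    weighted-bound v (u ∷ us) (u∉us ∷ unique-us) {T} T⊆R = by-cases (u ∈? T)
      where
      open ≤-Reasoning
      K = κ ^ length us
      P = ∏ us (λ u → κ + 2 * multiplicity G u v)
      CT = adaptedCount A T
      d = multiplicity G u v
      IH : ∀ {S} → S ⊆ R → K * weighted A v S us ≤ adaptedCount A S * P
      IH = weighted-bound v us unique-us
      collect : ∀ κ c p d → κ * (c * p) + d * (2 * c * p) ≡ c * ((κ + 2 * d) * p)
      collect = solve-∀
      by-cases : Dec (u ∈ₛ T) → κ * K * weighted A v T (u ∷ us) ≤ CT * ((κ + 2 * d) * P)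
      by-cases (no u∉T) = begin
        κ * K * weighted A v T (u ∷ us)   ≡⟨ cong (κ * K *_) (trans (weighted-∷ A v T u us)
                                              (trans (cong (weighted A v T us +_) (blockedBy-∉ A v us u∉T)) (+-identityʳ _))) ⟩
        κ * K * weighted A v T us         ≡⟨ *-assoc κ K _ ⟩
        κ * (K * weighted A v T us)       ≤⟨ *-monoʳ-≤ κ (IH T⊆R) ⟩
        κ * (CT * P)                      ≤⟨ m≤m+n _ _ ⟩
        κ * (CT * P) + d * (2 * CT * P)   ≡⟨ collect κ CT P d ⟩
        CT * ((κ + 2 * d) * P)            ∎
      by-cases (yes u∈T) = begin
        κ * K * weighted A v T (u ∷ us)                       ≡⟨ cong (κ * K *_) (weighted-∷ A v T u us) ⟩
        κ * K * (weighted A v T us + blockedBy A v T u us)    ≡⟨ *-distribˡ-+ (κ * K) _ _ ⟩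
        κ * K * weighted A v T us + κ * K * blockedBy A v T u us
          ≤⟨ +-mono-≤ (≤-trans (≤-reflexive (*-assoc κ K _)) (*-monoʳ-≤ κ (IH T⊆R)))
                      (*-monoʳ-≤ (κ * K) (blockedBy-∈ A v us u∈T (unique (T⊆R u∈T)) u∉us)) ⟩
        κ * (CT * P) + κ * K * (d * weighted A v (T - u) us)  ≡⟨ cong (κ * (CT * P) +_) (regroup κ K d _) ⟩
        κ * (CT * P) + d * (κ * (K * weighted A v (T - u) us))
          ≤⟨ +-monoʳ-≤ (κ * (CT * P)) (*-monoʳ-≤ d (*-monoʳ-≤ κ (IH (T⊆R ∘ p─q⊆p T _)))) ⟩
        κ * (CT * P) + d * (κ * (adaptedCount A (T - u) * P)) ≡⟨ cong (λ x → κ * (CT * P) + d * x) (sym (*-assoc κ _ P)) ⟩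
        κ * (CT * P) + d * (κ * adaptedCount A (T - u) * P)
          ≤⟨ +-monoʳ-≤ (κ * (CT * P)) (*-monoʳ-≤ d (*-monoˡ-≤ P (removal-ratio ∣ T ∣ ≤-refl T⊆R u∈T))) ⟩
        κ * (CT * P) + d * (2 * CT * P)                       ≡⟨ collect κ CT P d ⟩
        CT * ((κ + 2 * d) * P)                                ∎
        where
        regroup : ∀ κ K d W → κ * K * (d * W) ≡ d * (κ * (K * W))
        regroup = solve-∀

module TwoRounds (G : Multigraph) (μ : ℕ) (max : IsMaxMultiplicity G μ) (j : ℕ) (1≤j : 1 ≤ j)
                 (μ[2m]≤j^4 : μ * (2 * m G) ≤ j ^ 4) (m<2^j : m G < 2 ^ j) where

  open Graph G

  high? : Decidable (λ v → j * j < degree v)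
  high? v = j * j <? degree v

  High : Subset (n G)
  High = ⟦ high? ⟧

  low-degree : ∀ {v} → v ∉ₛ High → degree v ≤ j * j
  low-degree v∉High = ≮⇒≥ (v∉High ∘ ∈⟦⟧⁺ high?)

  #High : ℕ
  #High = ∑ vertices λ w → 𝟙 (w ∈? High)

  #High*[1+j²]≤2m : #High * suc (j * j) ≤ 2 * m G
  #High*[1+j²]≤2m = ≤-trans (≤-reflexive (sym (∑-*ʳ vertices (suc (j * j)) _))) (≤-trans (∑-mono vertices pointwise) handshake)
    where
    pointwise : ∀ w → w ∈ vertices → 𝟙 (w ∈? High) * suc (j * j) ≤ degree w
    pointwise w _ with w ∈? High
    ... | no  _      = z≤n
    ... | yes w∈High = ≤-trans (≤-reflexive (+-identityʳ _)) (∈⟦⟧⁻ high? w∈High)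

  μ#High≤j² : μ * #High ≤ j * j
  μ#High≤j² = *-cancelʳ-≤ _ _ (j * j) {{>-nonZero (*-mono-≤ 1≤j 1≤j)}} (begin
    μ * #High * (j * j)          ≡⟨ *-assoc μ #High (j * j) ⟩
    μ * (#High * (j * j))        ≤⟨ *-monoʳ-≤ μ (≤-trans (*-monoʳ-≤ #High (n≤1+n (j * j))) #High*[1+j²]≤2m) ⟩
    μ * (2 * m G)                ≤⟨ μ[2m]≤j^4 ⟩
    j ^ 4                        ≡⟨ pow4 j ⟩
    j * j * (j * j)              ∎)
    where
    open ≤-Reasoning
    pow4 : ∀ j → j * (j * (j * (j * 1))) ≡ j * j * (j * j)
    pow4 = solve-∀

  degreeIn-High : ∀ v → degreeIn High v ≤ j * j
  degreeIn-High v = begin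
    degreeIn High v                         ≤⟨ ∑-mono vertices (λ w _ → *-monoʳ-≤ (𝟙 (w ∈? High)) (proj₁ max w v)) ⟩
    ∑ vertices (λ w → 𝟙 (w ∈? High) * μ)    ≡⟨ ∑-*ʳ vertices μ _ ⟩
    #High * μ                               ≡⟨ *-comm #High μ ⟩
    μ * #High                               ≤⟨ μ#High≤j² ⟩
    j * j                                   ∎
    where open ≤-Reasoning

  module _ (L : V → List ℕ) (ℓ : Fin (m G) → ℕ) (L-lists : IsListAssignment G (4 * j) L) (ℓ-pos : IsLabelling G ℓ) where

    open Counting G ℓ ℓ-pos

    private
      1≤4j : 1 ≤ 4 * j
      1≤4j = ≤-trans 1≤j (m≤n*m j 4)

      4[j*j]≤4j*4j : 4 * (j * j) ≤ 4 * j * (4 * j)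
      4[j*j]≤4j*4j = ≤-trans (m≤m+n _ (12 * (j * j))) (≤-reflexive (expand j))
        where
        expand : ∀ j → 4 * (j * j) + 12 * (j * j) ≡ 4 * j * (4 * j)
        expand = solve-∀

    module Round₁ = Sparse L High (4 * j) 1≤4j (λ {v} _ → ≤-reflexive (sym (proj₁ (L-lists v))))
                      (λ {v} _ → proj₁ (proj₂ (L-lists v)))
                      (λ {v} _ → ≤-trans (*-monoʳ-≤ 4 (degreeIn-High v)) 4[j*j]≤4j*4j)

    weighted-low : ∀ {v} → v ∉ₛ High → weighted L v High vertices ≤ adaptedCount L High * 2 ^ j
    weighted-low {v} v∉High = *-cancelʳ-≤ _ _ (κ ^ length vertices * κ ^ D) {{κ^n*κ^D≢0}} (begin
      W * (κ ^ length vertices * κ ^ D)        ≡⟨ *-CS.x∙yz≈yx∙z W (κ ^ length vertices) (κ ^ D) ⟩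
      κ ^ length vertices * W * κ ^ D          ≤⟨ *-monoˡ-≤ (κ ^ D) (Round₁.weighted-bound v vertices (allFin⁺ (n G)) id) ⟩
      C * Π * κ ^ D                            ≡⟨ *-assoc C Π (κ ^ D) ⟩
      C * (Π * κ ^ D)                          ≤⟨ *-monoʳ-≤ C (∏-bernoulli κ 2 (λ u → multiplicity G u v) vertices) ⟩
      C * (κ ^ length vertices * (κ + 2) ^ D)  ≤⟨ *-monoʳ-≤ C (*-monoʳ-≤ (κ ^ length vertices)
                                                    ([4j+2]^D≤2^t[4j]^D j j D 1≤j (low-degree v∉High))) ⟩
      C * (κ ^ length vertices * (2 ^ j * κ ^ D)) ≡⟨ rearrange C (κ ^ length vertices) (2 ^ j) (κ ^ D) ⟩
      C * 2 ^ j * (κ ^ length vertices * κ ^ D) ∎)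
      where
      open ≤-Reasoning
      κ = 4 * j
      D = degree v
      W = weighted L v High vertices
      C = adaptedCount L High
      Π = ∏ vertices (λ u → κ + 2 * multiplicity G u v)
      κ^n*κ^D≢0 : NonZero (κ ^ length vertices * κ ^ D)
      κ^n*κ^D≢0 = >-nonZero (*-mono-≤ (m^n>0 κ {{>-nonZero 1≤4j}} (length vertices)) (m^n>0 κ {{>-nonZero 1≤4j}} D))
      rearrange : ∀ c a t b → c * (a * (t * b)) ≡ c * t * (a * b)
      rearrange = solve-∀

    active? : Decidable (λ v → v ∉ₛ High × 1 ≤ degree v)
    active? v = ¬? (v ∈? High) ×-dec (1 ≤? degree v)

    potential : Colouring → ℕ
    potential c = ∑ vertices λ v → 𝟙 (active? v) * 2 ^ blockers v c vertices

    #active<2^[1+j] : ∑ vertices (𝟙 ∘ active?) < 2 ^ suc j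
    #active<2^[1+j] = ≤-<-trans (≤-trans (∑-mono vertices (λ v _ → 𝟙active≤degree v (active? v))) handshake) (*-monoʳ-< 2 m<2^j)
      where
      𝟙active≤degree : ∀ v (a : Dec (v ∉ₛ High × 1 ≤ degree v)) → 𝟙 a ≤ degree v
      𝟙active≤degree v (yes (_ , 1≤deg)) = 1≤deg
      𝟙active≤degree v (no _)            = z≤n

    expected-potential : ∑ᶜ (restrict L High) (λ c → good c * potential c)
                           < ∑ᶜ (restrict L High) (λ c → good c * 2 ^ suc (2 * j))
    expected-potential = begin-strict
      ∑ᶜ R (λ c → good c * potential c)
        ≡⟨ ∑ᶜ-cong R (λ c _ → trans (sym (∑-*ˡ vertices (good c) _)) (∑-cong vertices (λ v _ → *-CS.x∙yz≈y∙xz (good c) (𝟙 (active? v)) _))) ⟩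
      ∑ᶜ R (λ c → ∑ vertices (λ v → 𝟙 (active? v) * (good c * 2 ^ blockers v c vertices)))
        ≡⟨ ∑ᶜ-∑ R vertices _ ⟩
      ∑ vertices (λ v → ∑ᶜ R (λ c → 𝟙 (active? v) * (good c * 2 ^ blockers v c vertices)))
        ≡⟨ ∑-cong vertices (λ v _ → ∑ᶜ-*ˡ R (𝟙 (active? v)) _) ⟩
      ∑ vertices (λ v → 𝟙 (active? v) * weighted L v High vertices)
        ≤⟨ ∑-mono vertices (λ v _ → pointwise v (active? v)) ⟩
      ∑ vertices (λ v → 𝟙 (active? v) * (C * 2 ^ j))
        ≡⟨ ∑-*ʳ vertices _ _ ⟩
      ∑ vertices (𝟙 ∘ active?) * (C * 2 ^ j)
        <⟨ *-monoˡ-< (C * 2 ^ j) {{>-nonZero (*-mono-≤ 1≤C (m^n>0 2 j))}} #active<2^[1+j] ⟩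
      2 * 2 ^ j * (C * 2 ^ j)
        ≡⟨ rearrange (2 ^ j) C ⟩
      2 * (2 ^ j * 2 ^ j) * C
        ≡⟨ cong (λ p → 2 * p * C) (trans (sym (^-distribˡ-+-* 2 j j)) (cong (λ k → 2 ^ (j + k)) (sym (+-identityʳ j)))) ⟩
      2 ^ suc (2 * j) * C
        ≡⟨ trans (sym (∑ᶜ-*ˡ R (2 ^ suc (2 * j)) good)) (∑ᶜ-cong R (λ c _ → *-comm (2 ^ suc (2 * j)) (good c))) ⟩
      ∑ᶜ R (λ c → good c * 2 ^ suc (2 * j)) ∎
      where
      open ≤-Reasoning
      R = restrict L High
      C = adaptedCount L High
      1≤C : 1 ≤ C
      1≤C = Round₁.adaptedCount-pos ∣ High ∣ ≤-refl id
      pointwise : ∀ v (a : Dec (v ∉ₛ High × 1 ≤ degree v)) → 𝟙 a * weighted L v High vertices ≤ 𝟙 a * (C * 2 ^ j)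
      pointwise v (yes (v∉High , _)) = *-monoʳ-≤ 1 (weighted-low v∉High)
      pointwise v (no _)             = z≤n
      rearrange : ∀ p C → 2 * p * (C * p) ≡ 2 * (p * p) * C
      rearrange = solve-∀

    few-blockers : ∀ c → potential c < 2 ^ suc (2 * j) → ∀ {v} → v ∉ₛ High → blockers v c vertices ≤ 2 * j
    few-blockers c small {v} v∉High with 1 ≤? degree v
    ... | no  deg≱1 = ≤-trans (blockers≤degree v c) (≤-trans (≤-pred (≰⇒> deg≱1)) z≤n)
    ... | yes 1≤deg = ≮⇒≥ λ 2j<blockers → <⇒≱ small (begin
      2 ^ suc (2 * j)                                ≤⟨ ^-monoʳ-≤ 2 2j<blockers ⟩
      2 ^ blockers v c vertices                      ≡⟨ +-identityʳ _ ⟨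
      1 * 2 ^ blockers v c vertices                  ≡⟨ cong (_* 2 ^ blockers v c vertices) (𝟙-yes (active? v) (v∉High , 1≤deg)) ⟨
      𝟙 (active? v) * 2 ^ blockers v c vertices      ≤⟨ ∈⇒≤∑ vertices (λ v → 𝟙 (active? v) * 2 ^ blockers v c vertices) (∈-allFin v) ⟩
      potential c                                    ∎)
      where open ≤-Reasoning

    -- Opaque for the same reason as adapted-choice.
    opaque
      first-round : ∃[ c ] c ∈ᶜ restrict L High × Adapted G ℓ (lookup c) × (∀ {v} → v ∉ₛ High → blockers v c vertices ≤ 2 * j)
      first-round = pick (∑ᶜ<∑ᶜ⇒∃< (restrict L High) {λ c → good c * potential c} {λ c → good c * 2 ^ suc (2 * j)}
                                    expected-potential)
        where
        pick : ∃[ c ] c ∈ᶜ restrict L High × good c * potential c < good c * 2 ^ suc (2 * j) →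
               ∃[ c ] c ∈ᶜ restrict L High × Adapted G ℓ (lookup c) × (∀ {v} → v ∉ₛ High → blockers v c vertices ≤ 2 * j)
        pick (c , c∈ , lt) = c , c∈ , 𝟙>0⇒ (adapted? c) (m*n<m*o⇒0<m {good c} {potential c} {2 ^ suc (2 * j)} lt)
                                   , few-blockers c (*-cancelˡ-< (good c) (potential c) (2 ^ suc (2 * j)) lt)

    module Round₂ (c₁ : Colouring) (c₁∈ : c₁ ∈ᶜ restrict L High) (c₁-adapted : Adapted G ℓ (lookup c₁))
                  (few : ∀ {v} → v ∉ₛ High → blockers v c₁ vertices ≤ 2 * j) where

      Lost : V → ℕ → Set
      Lost v x = ∃[ u ] Blocks u x v × lookup c₁ u ≡ x

      lost? : ∀ v x → Dec (Lost v x)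
      lost? v x = any? λ u → blocks? u x v ×-dec (lookup c₁ u ≟ x)

      remaining : V → List ℕ
      remaining v = filter (¬? ∘ lost? v) (L v)

      #lost≤blockers : ∀ v → ∑ (L v) (𝟙 ∘ lost? v) ≤ blockers v c₁ vertices
      #lost≤blockers v = begin
        ∑ (L v) (𝟙 ∘ lost? v)                      ≤⟨ ∑-mono (L v) (λ x _ → 𝟙lost≤ x (lost? v x)) ⟩
        ∑ (L v) (λ x → ∑ vertices (λ u → F u x))   ≡⟨ ∑-comm (L v) vertices _ ⟩
        ∑ vertices (λ u → ∑ (L v) (F u))           ≤⟨ ∑-mono vertices (λ u _ →
                                                        ∑-𝟙≡-unique _≟_ (L v) (proj₁ (proj₂ (L-lists v))) (lookup c₁ u) (λ _ → B u)) ⟩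
        blockers v c₁ vertices                     ∎
        where
        open ≤-Reasoning
        B : V → ℕ
        B u = 𝟙 (blocks? u (lookup c₁ u) v)
        F : V → ℕ → ℕ
        F u x = 𝟙 (x ≟ lookup c₁ u) * B u
        𝟙lost≤ : ∀ x (d : Dec (Lost v x)) → 𝟙 d ≤ ∑ vertices (λ u → F u x)
        𝟙lost≤ x (no _) = z≤n
        𝟙lost≤ x (yes (u , blocks , c₁u≡x)) = begin
          1                            ≡⟨ cong₂ _*_ (𝟙-yes (x ≟ lookup c₁ u) (sym c₁u≡x))
                                                    (𝟙-yes (blocks? u (lookup c₁ u) v) (subst (λ y → Blocks u y v) (sym c₁u≡x) blocks)) ⟨
          F u x                        ≤⟨ ∈⇒≤∑ vertices (λ u → F u x) (∈-allFin u) ⟩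
          ∑ vertices (λ u → F u x)     ∎

      remaining-long : ∀ {v} → v ∈ₛ ∁ High → 2 * j ≤ length (remaining v)
      remaining-long {v} v∈Low = +-cancelʳ-≤ (∑ (L v) (𝟙 ∘ lost? v)) _ _ (begin
        2 * j + ∑ (L v) (𝟙 ∘ lost? v)                        ≤⟨ +-monoʳ-≤ (2 * j) (≤-trans (#lost≤blockers v) (few (x∈∁p⇒x∉p v∈Low))) ⟩
        2 * j + 2 * j                                        ≡⟨ 2n+2n≡4n j ⟩
        4 * j                                                ≡⟨ proj₁ (L-lists v) ⟨
        length (L v)                                         ≡⟨ length-filter-¬+∑𝟙 (lost? v) (L v) ⟨
        length (remaining v) + ∑ (L v) (𝟙 ∘ lost? v)         ∎)
        where
        open ≤-Reasoning

      remaining-sparse : ∀ {v} → v ∈ₛ ∁ High → 4 * degreeIn (∁ High) v ≤ 2 * j * (2 * j)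
      remaining-sparse {v} v∈Low = ≤-trans (*-monoʳ-≤ 4 (≤-trans (degreeIn≤degree (∁ High) v) (low-degree (x∈∁p⇒x∉p v∈Low))))
                                           (≤-reflexive (expand j))
        where
        expand : ∀ j → 4 * (j * j) ≡ 2 * j * (2 * j)
        expand = solve-∀

      module Sparse₂ = Sparse remaining (∁ High) (2 * j) (≤-trans 1≤j (m≤n*m j 2)) remaining-long
                         (λ {v} _ → filter⁺ (¬? ∘ lost? v) (proj₁ (proj₂ (L-lists v)))) remaining-sparse

      c₂ : Colouring
      c₂ = proj₁ Sparse₂.adapted-choice

      colour : V → ℕ
      colour v = lookup c₁ v + lookup c₂ v

      colour-high : ∀ {v} → v ∈ₛ High → colour v ≡ lookup c₁ v
      colour-high {v} v∈High = trans (cong (lookup c₁ v +_) (∈ᶜ-restrict-∉ remaining c₂ (proj₁ (proj₂ Sparse₂.adapted-choice))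
                                                 (x∈p⇒x∉∁p v∈High))) (+-identityʳ (lookup c₁ v))

      colour-low : ∀ {v} → v ∉ₛ High → colour v ≡ lookup c₂ v
      colour-low {v} v∉High = cong (_+ lookup c₂ v) (∈ᶜ-restrict-∉ L c₁ c₁∈ v∉High)

      c₂∈remaining : ∀ {v} → v ∉ₛ High → lookup c₂ v ∈ remaining v
      c₂∈remaining {v} v∉High =
        subst (lookup c₂ v ∈_) (restrict-∈ remaining (x∉p⇒x∈∁p v∉High)) (proj₁ (proj₂ Sparse₂.adapted-choice) v)

      colour-∈ : IsLColouring G L colour
      colour-∈ v = by-cases (v ∈? High)
        where
        by-cases : Dec (v ∈ₛ High) → colour v ∈ L v
        by-cases (yes v∈High) = subst (_∈ L v) (sym (colour-high v∈High)) (subst (lookup c₁ v ∈_) (restrict-∈ L v∈High) (c₁∈ v))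
        by-cases (no  v∉High) = subst (_∈ L v) (sym (colour-low v∉High)) (proj₁ (∈-filter⁻ (¬? ∘ lost? v) {xs = L v} (c₂∈remaining v∉High)))

      no-mixed-conflict : ∀ {u w e} → Joins G u w e → u ∈ₛ High → w ∉ₛ High →
                          colour u ≡ ℓ e → colour w ≡ ℓ e → ⊥
      no-mixed-conflict {u} {w} {e} joins u∈High w∉High cu≡ℓ cw≡ℓ =
        proj₂ (∈-filter⁻ (¬? ∘ lost? w) {xs = L w} (c₂∈remaining w∉High))
              (u , (e , joins , sym c₂w≡ℓ) , trans (trans (sym (colour-high u∈High)) cu≡ℓ) (sym c₂w≡ℓ))
        where
        c₂w≡ℓ : lookup c₂ w ≡ ℓ e
        c₂w≡ℓ = trans (sym (colour-low w∉High)) cw≡ℓ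

      colour-adapted : Adapted G ℓ colour
      colour-adapted e (c₁≡ℓ , c₂≡ℓ) = by-cases (end₁ e ∈? High) (end₂ e ∈? High)
        where
        by-cases : Dec (end₁ e ∈ₛ High) → Dec (end₂ e ∈ₛ High) → ⊥
        by-cases (yes a∈High) (yes b∈High) = c₁-adapted e (trans (sym (colour-high a∈High)) c₁≡ℓ , trans (sym (colour-high b∈High)) c₂≡ℓ)
        by-cases (yes a∈High) (no  b∉High) = no-mixed-conflict (inj₁ (refl , refl)) a∈High b∉High c₁≡ℓ c₂≡ℓ
        by-cases (no  a∉High) (yes b∈High) = no-mixed-conflict (inj₂ (refl , refl)) b∈High a∉High c₂≡ℓ c₁≡ℓ
        by-cases (no  a∉High) (no  b∉High) = proj₂ (proj₂ Sparse₂.adapted-choice) e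
                                               (trans (sym (colour-low a∉High)) c₁≡ℓ , trans (sym (colour-low b∉High)) c₂≡ℓ)

    adapted-colouring : ∃[ c ] IsLColouring G L c × Adapted G ℓ c
    adapted-colouring with first-round
    ... | c₁ , c₁∈ , c₁-adapted , few = colour , colour-∈ , colour-adapted
      where open Round₂ c₁ c₁∈ c₁-adapted few

  adaptably-choosable : AdaptablyChoosable G (4 * j)
  adaptably-choosable = adapted-colouring

theorem11 : (G : Multigraph) (μ : ℕ) → 2 ^ 16 ≤ m G → 1 ≤ μ → IsMaxMultiplicity G μ →
    ∃[ k ] (AdaptablyChoosable G k × WithinBound μ (m G) k)
theorem11 G μ 2^16≤m 1≤μ max = from-bracket (between-fourth-powers (μ * (2 * m G)) 1≤μ[2m])
  where
  1≤μ[2m] : 1 ≤ μ * (2 * m G)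
  1≤μ[2m] = *-mono-≤ 1≤μ (≤-trans (≤-trans (m^n>0 2 16) 2^16≤m) (m≤n*m (m G) 2))
  from-bracket : ∃[ i ] ¬ μ * (2 * m G) ≤ i ^ 4 × μ * (2 * m G) ≤ suc i ^ 4 →
                 ∃[ k ] (AdaptablyChoosable G k × WithinBound μ (m G) k)
  from-bracket (i , i-small , j-large) = 4 * suc i , adaptably-choosable , 0 , within-bound
    where
    open ParameterChoice μ (m G) i 1≤μ 2^16≤m i-small j-large
    open TwoRounds G μ max (suc i) (s≤s z≤n) j-large M<2^j
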